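{- Let $\mathfrak{g}=\mathfrak{g}(A)$ be a Kac–Moody algebra with Dynkin node set $I$ and Weyl group $W$, let $(\Lambda,K)\in P^+\times Z^+$, and fix $J\subset I$. If $\Lambda$ is supported on $I\setminus J$, i.e. $\Lambda=\sum_{j\in I\setminus J}a_j\Lambda_j$, then the induced subgraphs of $\Gamma_s(\Lambda)$ and $\Gamma_w(K)$ on the vertex set $W^J$ satisfy $D U-UD=\langle K,\Lambda\rangle\mathrm{Id}$ on $\mathbb{Z}W^J$, where $U$ is the up operator of the restriction of $\Gamma_s(\Lambda)$ and $D$ the down operator of the restriction of $\Gamma_w(K)$; i.e. they form a pair of dual graded graphs with differential coefficient $\langle K,\Lambda\rangle$.
   Context: Notation: simple roots $\alpha_i$, coroots $\alpha_i^\vee$, fundamental weights $\Lambda_i$, pairing $\langle\cdot,\cdot\rangle$; $W$ generated by $s_i$, length $\ell$; for real positive root $\alpha=u\alpha_i$, $\alpha^\vee=u\alpha_i^\vee$, $s_\alpha=us_iu^{ -1}$. Strong order covers $w\lessdot ws_\alpha$ ($\ell(ws_\alpha)=\ell(w)+1$); left weak covers $w\prec s_iw$ ($\ell(s_iw)=\ell(w)+1$). $P^+$ dominant integral weights; $Z^+=Z(\mathfrak{g})\cap\bigoplus_i\mathbb{Z}_{\ge0}\alpha_i^\vee$, $K=\sum k_i\alpha_i^\vee$. $\Gamma_s(\Lambda)$: graph on $W$ graded by $\ell$, edge $v\to vs_\alpha$ for each strong cover, multiplicity $\langle\alpha^\vee,\Lambda\rangle$. $\Gamma_w(K)$: graph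 on $W$ graded by $\ell$, edge $v\to s_iv$ for each left weak cover, multiplicity $k_i$. For a graded graph with multiplicities $m$, $U(v)=\sum_{(v,w)}m(v,w)w$, $D(w)=\sum_{(v,w)}m(v,w)v$. $W_J$ is the parabolic subgroup generated by $s_j$, $j\in J$, and $W^J$ is the set of minimal length coset representatives of $W/W_J$; the restricted graphs keep exactly those edges with both endpoints in $W^J$. -}

module Defs where

open import Data.Nat as ℕ using (ℕ; zero; suc)
open import Data.Integer as ℤ using (ℤ; +_; _+_; _-_; _*_; 0ℤ)
open import Data.Fin as Fin using (Fin)
open import Data.Fin.Properties using (all?)
open import Data.Fin.Subset using (Subset; _∈_)
open import Data.List using (List; []; _∷_; _++_; reverse; length)
open import Data.List.Relation.Unary.All using (All)
open import Data.Bool using (Bool; true; false; if_then_else_; _∧_)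
open import Data.Product using (Σ; _×_; _,_)
open import Relation.Nullary using (Dec; ¬_; does)
open import Relation.Binary.PropositionalEquality using (_≡_; _≢_)

-- A (generalized Cartan) matrix, A i j = a_ij = ⟨α_i^∨ , α_j⟩.
Matrix : ℕ → Set
Matrix n = Fin n → Fin n → ℤ

IsGCM : ∀ {n} → Matrix n → Set
IsGCM {n} A =
  (∀ i → A i i ≡ + 2) ×
  (∀ i j → i ≢ j → A i j ℤ.≤ 0ℤ) ×
  (∀ i j → A i j ≡ 0ℤ → A j i ≡ 0ℤ)

-- Integer vectors indexed by I: coordinates w.r.t. simple roots
-- (root lattice) or w.r.t. simple coroots (coroot lattice).
Vecℤ : ℕ → Set
Vecℤ n = Fin n → ℤ

ΣI : ∀ n → (Fin n → ℤ) → ℤ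
ΣI zero    f = 0ℤ
ΣI (suc n) f = f Fin.zero + ΣI n (λ i → f (Fin.suc i))

e : ∀ {n} → Fin n → Vecℤ n
e j k = if does (j Fin.≟ k) then + 1 else 0ℤ

module _ {n : ℕ} (A : Matrix n) where

  sRoot : Fin n → Vecℤ n → Vecℤ n
  sRoot i β k = β k - ΣI n (λ j → A i j * β j) * e i k

  sCoroot : Fin n → Vecℤ n → Vecℤ n
  sCoroot i γ k = γ k - ΣI n (λ j → γ j * A j i) * e i k

-- Elements of W are represented by words in the generators;
-- the word i₁ ∷ … ∷ iₖ ∷ [] stands for s_{i₁} ⋯ s_{iₖ}.
Word : ℕ → Set
Word n = List (Fin n)

module _ {n : ℕ} (A : Matrix n) where

  act : Word n → Vecℤ n → Vecℤ n
  act []      β = β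
  act (i ∷ w) β = sRoot A i (act w β)

  coact : Word n → Vecℤ n → Vecℤ n
  coact []      γ = γ
  coact (i ∷ w) γ = sCoroot A i (coact w γ)

  -- Equality in W: two words define the same element of W iff they act
  -- identically on the root lattice (W acts faithfully on it).
  _≈W_ : Word n → Word n → Set
  w ≈W w' = ∀ j k → act w (e j) k ≡ act w' (e j) k

  _≈W?_ : ∀ w w' → Dec (w ≈W w')
  w ≈W? w' = all? (λ j → all? (λ k → act w (e j) k ℤ.≟ act w' (e j) k))

  IsLength : (Word n → ℕ) → Set
  IsLength ℓ = ∀ w →
    (Σ (Word n) λ w' → (w' ≈W w) × (length w' ≡ ℓ w)) ×
    (∀ w' → w' ≈W w → ℓ w ℕ.≤ length w')

  Positive : Vecℤ n → Set
  Positive β = ∀ k → 0ℤ ℤ.≤ β k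

  -- w ∈ W^J : w has minimal length in its coset w W_J
  InWJ : (Word n → ℕ) → Subset n → Word n → Set
  InWJ ℓ J w = ∀ u → All (_∈ J) u → ℓ w ℕ.≤ ℓ (w ++ u)

  -- Strong cover v ⋖ w = v s_α, with α = u α_j a positive real root,
  -- s_α = u s_j u⁻¹, ℓ(v s_α) = ℓ(v) + 1.
  StrongCoverVia : (Word n → ℕ) → Word n → Word n → Word n → Fin n → Set
  StrongCoverVia ℓ v w u j =
    (w ≈W (v ++ (u ++ (j ∷ reverse u)))) ×
    Positive (act u (e j)) ×
    (ℓ w ≡ suc (ℓ v))

  -- pairing ⟨γ , Λ⟩ for γ in the coroot lattice, Λ given by a_i = ⟨α_i^∨,Λ⟩
  pairΛ : (Fin n → ℕ) → Vecℤ n → ℤ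
  pairΛ a γ = ΣI n (λ i → γ i * + a i)

  -- sm v w is the multiplicity of the edge v → w in Γ_s(Λ):
  -- ⟨α^∨,Λ⟩ (with α^∨ = u α_j^∨) if w = v s_α is a strong cover, 0 otherwise.
  IsStrongMult : (Word n → ℕ) → (Fin n → ℕ) → (Word n → Word n → ℤ) → Set
  IsStrongMult ℓ a sm = ∀ v w →
    (∀ u j → StrongCoverVia ℓ v w u j → sm v w ≡ pairΛ a (coact u (e j))) ×
    (¬ (Σ (Word n) λ u → Σ (Fin n) λ j → StrongCoverVia ℓ v w u j) → sm v w ≡ 0ℤ)

-- K = Σ k_i α_i^∨ is central: ⟨K, α_j⟩ = Σ_i k_i a_ij = 0 for all j.
IsCentral : ∀ {n} → Matrix n → (Fin n → ℕ) → Set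
IsCentral {n} A k = ∀ j → ΣI n (λ i → + k i * A i j) ≡ 0ℤ

pairKΛ : ∀ {n} → (Fin n → ℕ) → (Fin n → ℕ) → ℤ
pairKΛ {n} k a = ΣI n (λ i → + (k i ℕ.* a i))

module _ {n : ℕ} (A : Matrix n) (ℓ : Word n → ℕ) (J : Subset n)
         (decWJ : ∀ w → Dec (InWJ A ℓ J w))
         (k : Fin n → ℕ) (sm : Word n → Word n → ℤ) where

  -- coefficient of x in D(U(v)), U = up operator of Γ_s(Λ)|W^J,
  -- D = down operator of Γ_w(K)|W^J.  U(v) = Σ_w sm v w · w, and the
  -- weak edges into w are x → s_i x = w with multiplicity k_i.
  DUcoef : Word n → Word n → ℤ
  DUcoef v x = ΣI n λ i →
    if does (ℓ (i ∷ x) ℕ.≟ suc (ℓ x)) ∧ does (decWJ (i ∷ x))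
    then sm v (i ∷ x) * + k i
    else 0ℤ

  -- coefficient of x in U(D(v)): D(v) = Σ k_i y over weak edges
  -- y → s_i y = v, i.e. y = s_i v with ℓ(v) = ℓ(y)+1, y ∈ W^J.
  UDcoef : Word n → Word n → ℤ
  UDcoef v x = ΣI n λ i →
    if does (ℓ v ℕ.≟ suc (ℓ (i ∷ v))) ∧ does (decWJ (i ∷ v))
    then + k i * sm (i ∷ v) x
    else 0ℤ

IdCoef : ∀ {n} → Matrix n → ℤ → Word n → Word n → ℤ
IdCoef A c v x = if does (_≈W?_ A v x) then c else 0ℤ

{-# OPTIONS --safe #-}
-- For v, x ∈ W^J the coefficient of x in (DU − UD)(v) is Σᵢ kᵢ (m(v, sᵢx) − m(sᵢv, x)), where m is
-- the strong multiplicity and the terms are present only when sᵢx > x, sᵢx ∈ W^J, resp. sᵢv < v,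
-- sᵢv ∈ W^J. For v ≠ x the edges v → sᵢx and sᵢv → x use the same reflection, so their
-- multiplicities agree; when only one of them is present, the lifting property of strong covers
-- (or, if sᵢx ∉ W^J, Deodhar's lemma sᵢx = x s_j with j ∈ J) shows that the edge does not exist.
-- For v = x the i-th term is kᵢ ⟨v⁻¹αᵢ^∨, Λ⟩ in every case (if sᵢv = v s_j ∉ W^J it vanishes since
-- Λ is supported off J), and Σᵢ kᵢ v⁻¹αᵢ^∨ = v⁻¹K = K because K is central.
--
-- The Coxeter-theoretic input is derived from the action of words on the root lattice: w α_s is
-- positive exactly when ℓ(w s) > ℓ(w), by induction on ℓ(w) with a reduction to dihedral subgroups,
-- whose alternating words are computed in coordinates (by evaluation for the finite types, through
-- the invariant 2c ≤ X d for X Y ≥ 4). The exchange condition, the lifting property and Deodhar's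
-- lemma follow from positivity.
module Submission where

open import Defs
open import Data.Nat as ℕ using (ℕ; zero; suc; z≤n; s≤s)
import Data.Nat.Properties as ℕP
open import Data.Integer as ℤ using (ℤ; +_; -_; _+_; _-_; _*_; _⊖_; 0ℤ; 1ℤ; -[1+_])
import Data.Integer.Properties as ℤP
open import Data.Integer.Tactic.RingSolver using (solve-∀)
open import Data.Nat.Tactic.RingSolver using () renaming (solve-∀ to ℕ-solve-∀)
open import Data.Fin as Fin using (Fin) renaming (zero to fz; suc to fs)
import Data.Fin.Properties as FinP
open import Data.Fin.Subset using (Subset; _∈_; _∉_)
open import Data.Fin.Subset.Properties using (_∈?_)
open import Data.Bool using (Bool; true; false; not; if_then_else_; _∧_)
open import Data.Product using (Σ; _×_; _,_; proj₁; proj₂)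
open import Data.Empty using (⊥; ⊥-elim)
open import Function using (_∘_)
open import Relation.Nullary using (Dec; yes; no; ¬_; does)
open import Relation.Nullary.Decidable using (True; _×-dec_; toWitness; decidable-stable)
open import Relation.Binary.PropositionalEquality
open import Relation.Binary.Bundles using (Setoid)
open import Relation.Binary.Definitions using (tri<; tri≈; tri>)
import Relation.Binary.Reasoning.Setoid as SetoidReasoning
open import Data.List using (List; []; _∷_; _++_; reverse; length)
import Data.List.Properties as LP
open import Data.List.Relation.Unary.All using (All; []; _∷_)
import Data.List.Relation.Unary.All.Properties as AllP
open import Data.List.Reverse using (Reverse; reverseView; []; _∶_∶ʳ_)
open import Data.Sum using (_⊎_; inj₁; inj₂)
open import Algebra.Properties.Semiring.Sum ℤP.+-*-semiring
  using (sum; sum-cong-≗; ∑-distrib-+; ∑-comm; *-distribˡ-sum)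

ΣI≡sum : ∀ n (f : Fin n → ℤ) → ΣI n f ≡ sum f
ΣI≡sum zero    f = refl
ΣI≡sum (suc n) f = cong (λ s → f fz + s) (ΣI≡sum n (f ∘ fs))

ΣI-cong : ∀ n {f g : Fin n → ℤ} → f ≗ g → ΣI n f ≡ ΣI n g
ΣI-cong n {f} {g} f≗g = trans (ΣI≡sum n f) (trans (sum-cong-≗ f≗g) (sym (ΣI≡sum n g)))

ΣI-distrib-+ : ∀ {n} (f g : Fin n → ℤ) → ΣI n (λ i → f i + g i) ≡ ΣI n f + ΣI n g
ΣI-distrib-+ {n} f g = trans (ΣI≡sum n _)
  (trans (∑-distrib-+ f g) (sym (cong₂ _+_ (ΣI≡sum n f) (ΣI≡sum n g))))

*-distribˡ-ΣI : ∀ {n} c (f : Fin n → ℤ) → c * ΣI n f ≡ ΣI n (λ i → c * f i)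
*-distribˡ-ΣI {n} c f = trans (cong (c *_) (ΣI≡sum n f))
  (trans (*-distribˡ-sum c f) (sym (ΣI≡sum n _)))

*-distribʳ-ΣI : ∀ {n} c (f : Fin n → ℤ) → ΣI n f * c ≡ ΣI n (λ i → f i * c)
*-distribʳ-ΣI {n} c f = trans (ℤP.*-comm (ΣI n f) c)
  (trans (*-distribˡ-ΣI c f) (ΣI-cong n (λ i → ℤP.*-comm c (f i))))

ΣI-comm : ∀ {m n} (f : Fin m → Fin n → ℤ) →
  ΣI m (λ i → ΣI n (f i)) ≡ ΣI n (λ j → ΣI m (λ i → f i j))
ΣI-comm {m} {n} f = begin
  ΣI m (λ i → ΣI n (f i))          ≡⟨ ΣI-cong m (λ i → ΣI≡sum n (f i)) ⟩
  ΣI m (λ i → sum (f i))           ≡⟨ ΣI≡sum m _ ⟩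
  sum (λ i → sum (f i))            ≡⟨ ∑-comm f ⟩
  sum (λ j → sum (λ i → f i j))    ≡⟨ sym (ΣI≡sum n _) ⟩
  ΣI n (λ j → sum (λ i → f i j))   ≡⟨ ΣI-cong n (λ j → sym (ΣI≡sum m _)) ⟩
  ΣI n (λ j → ΣI m (λ i → f i j))  ∎
  where open ≡-Reasoning

ΣI-zero : ∀ n → ΣI n (λ _ → 0ℤ) ≡ 0ℤ
ΣI-zero zero    = refl
ΣI-zero (suc n) = trans (ℤP.+-identityˡ _) (ΣI-zero n)

ΣI-distrib-neg : ∀ {n} (f : Fin n → ℤ) → ΣI n (λ i → - f i) ≡ - ΣI n f
ΣI-distrib-neg {n} f = trans (ΣI-cong n (λ i → sym (ℤP.-1*i≡-i (f i))))
  (trans (sym (*-distribˡ-ΣI -[1+ 0 ] f)) (ℤP.-1*i≡-i (ΣI n f)))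

ΣI-distrib-- : ∀ {n} (f g : Fin n → ℤ) → ΣI n (λ i → f i - g i) ≡ ΣI n f - ΣI n g
ΣI-distrib-- {n} f g =
  trans (ΣI-distrib-+ f (λ i → - g i)) (cong (λ s → ΣI n f + s) (ΣI-distrib-neg g))

ΣI-nonneg : ∀ {n} (f : Fin n → ℤ) → (∀ i → 0ℤ ℤ.≤ f i) → 0ℤ ℤ.≤ ΣI n f
ΣI-nonneg {zero}  f f≥0 = ℤP.≤-refl
ΣI-nonneg {suc n} f f≥0 = ℤP.+-mono-≤ (f≥0 fz) (ΣI-nonneg (f ∘ fs) (f≥0 ∘ fs))

e-diag : ∀ {n} (i : Fin n) → e i i ≡ 1ℤ
e-diag fz     = refl
e-diag (fs i) = e-diag i

e-off : ∀ {n} {i j : Fin n} → i ≢ j → e i j ≡ 0ℤ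
e-off {i = fz}   {fz}   i≢j = ⊥-elim (i≢j refl)
e-off {i = fz}   {fs j} i≢j = refl
e-off {i = fs i} {fz}   i≢j = refl
e-off {i = fs i} {fs j} i≢j = e-off (i≢j ∘ cong fs)

e-sym : ∀ {n} (i j : Fin n) → e i j ≡ e j i
e-sym fz     fz     = refl
e-sym fz     (fs j) = refl
e-sym (fs i) fz     = refl
e-sym (fs i) (fs j) = e-sym i j

e-nonneg : ∀ {n} (j k : Fin n) → 0ℤ ℤ.≤ e j k
e-nonneg j k with does (j Fin.≟ k)
... | true  = ℤ.+≤+ z≤n
... | false = ℤ.+≤+ z≤n

ΣI-selectˡ : ∀ n (j : Fin n) (f : Fin n → ℤ) → ΣI n (λ i → e j i * f i) ≡ f j
ΣI-selectˡ (suc n) fz f = begin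
  1ℤ * f fz + ΣI n (λ i → 0ℤ * f (fs i))  ≡⟨ cong₂ _+_ (ℤP.*-identityˡ (f fz))
                                                       (ΣI-cong n (λ i → ℤP.*-zeroˡ (f (fs i)))) ⟩
  f fz + ΣI n (λ _ → 0ℤ)                  ≡⟨ cong (λ s → f fz + s) (ΣI-zero n) ⟩
  f fz + 0ℤ                               ≡⟨ ℤP.+-identityʳ (f fz) ⟩
  f fz                                    ∎
  where open ≡-Reasoning
ΣI-selectˡ (suc n) (fs j) f =
  trans (cong₂ _+_ (ℤP.*-zeroˡ (f fz)) (ΣI-selectˡ n j (f ∘ fs))) (ℤP.+-identityˡ (f (fs j)))

ΣI-selectʳ : ∀ n (j : Fin n) (f : Fin n → ℤ) → ΣI n (λ i → f i * e j i) ≡ f j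
ΣI-selectʳ n j f = trans (ΣI-cong n (λ i → ℤP.*-comm (f i) (e j i))) (ΣI-selectˡ n j f)

-- Linear endomorphisms of ℤⁿ

Linear : ∀ {n} → (Vecℤ n → Vecℤ n) → Set
Linear {n} f = ∀ β k → f β k ≡ ΣI n (λ m → β m * f (e m) k)

LinearFunctional : ∀ {n} → (Vecℤ n → ℤ) → Set
LinearFunctional {n} φ = ∀ β → φ β ≡ ΣI n (λ m → β m * φ (e m))

module _ {n : ℕ} {f : Vecℤ n → Vecℤ n} (f-linear : Linear f) where

  linear-cong : ∀ {β γ} → β ≗ γ → f β ≗ f γ
  linear-cong {β} {γ} β≗γ k = begin
    f β k                               ≡⟨ f-linear β k ⟩
    ΣI n (λ m → β m * f (e m) k)        ≡⟨ ΣI-cong n (λ m → cong (_* f (e m) k) (β≗γ m)) ⟩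
    ΣI n (λ m → γ m * f (e m) k)        ≡⟨ f-linear γ k ⟨
    f γ k                               ∎
    where open ≡-Reasoning

  linear-combination : ∀ a b β γ →
    f (λ k → a * β k + b * γ k) ≗ (λ k → a * f β k + b * f γ k)
  linear-combination a b β γ k = begin
    f (λ k → a * β k + b * γ k) k
      ≡⟨ f-linear _ k ⟩
    ΣI n (λ m → (a * β m + b * γ m) * f (e m) k)
      ≡⟨ ΣI-cong n (λ m → distrib a b (β m) (γ m) (f (e m) k)) ⟩
    ΣI n (λ m → a * (β m * f (e m) k) + b * (γ m * f (e m) k))
      ≡⟨ ΣI-distrib-+ (λ m → a * (β m * f (e m) k)) (λ m → b * (γ m * f (e m) k)) ⟩
    ΣI n (λ m → a * (β m * f (e m) k)) + ΣI n (λ m → b * (γ m * f (e m) k))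
      ≡⟨ cong₂ _+_ (*-distribˡ-ΣI a (λ m → β m * f (e m) k)) (*-distribˡ-ΣI b (λ m → γ m * f (e m) k)) ⟨
    a * ΣI n (λ m → β m * f (e m) k) + b * ΣI n (λ m → γ m * f (e m) k)
      ≡⟨ cong₂ (λ x y → a * x + b * y) (f-linear β k) (f-linear γ k) ⟨
    a * f β k + b * f γ k
      ∎
    where
    open ≡-Reasoning
    distrib : ∀ a b x y g → (a * x + b * y) * g ≡ a * (x * g) + b * (y * g)
    distrib = solve-∀

  linear-scale : ∀ a β → f (λ k → a * β k) ≗ (λ k → a * f β k)
  linear-scale a β k = begin
    f (λ k → a * β k) k                  ≡⟨ linear-cong (λ k → sym (plus-zero a (β k))) k ⟩
    f (λ k → a * β k + 0ℤ * β k) k       ≡⟨ linear-combination a 0ℤ β β k ⟩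
    a * f β k + 0ℤ * f β k               ≡⟨ plus-zero a (f β k) ⟩
    a * f β k                            ∎
    where
    open ≡-Reasoning
    plus-zero : ∀ a x → a * x + 0ℤ * x ≡ a * x
    plus-zero = solve-∀

  linear-neg : ∀ β → f (λ k → - β k) ≗ (λ k → - f β k)
  linear-neg β k = trans (linear-cong (λ k → sym (ℤP.-1*i≡-i (β k))) k)
    (trans (linear-scale -[1+ 0 ] β k) (ℤP.-1*i≡-i (f β k)))

  linear-zero : f (λ _ → 0ℤ) ≗ (λ _ → 0ℤ)
  linear-zero k = trans (linear-cong (λ k → sym (ℤP.*-zeroˡ 1ℤ)) k)
    (trans (linear-scale 0ℤ (λ _ → 1ℤ) k) (ℤP.*-zeroˡ (f (λ _ → 1ℤ) k)))

id-linear : ∀ {n} → Linear {n} (λ β → β)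
id-linear {n} β k = sym (trans (ΣI-cong n (λ m → cong (β m *_) (e-sym m k))) (ΣI-selectʳ n k β))

∘-linear : ∀ {n} {f g : Vecℤ n → Vecℤ n} → Linear f → Linear g → Linear (f ∘ g)
∘-linear {n} {f} {g} f-linear g-linear β k = begin
  f (g β) k
    ≡⟨ f-linear (g β) k ⟩
  ΣI n (λ m → g β m * f (e m) k)
    ≡⟨ ΣI-cong n (λ m → trans (cong (_* f (e m) k) (g-linear β m))
                              (*-distribʳ-ΣI (f (e m) k) (λ p → β p * g (e p) m))) ⟩
  ΣI n (λ m → ΣI n (λ p → β p * g (e p) m * f (e m) k))
    ≡⟨ ΣI-comm (λ m p → β p * g (e p) m * f (e m) k) ⟩
  ΣI n (λ p → ΣI n (λ m → β p * g (e p) m * f (e m) k))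
    ≡⟨ ΣI-cong n (λ p → trans (ΣI-cong n (λ m → ℤP.*-assoc (β p) _ _))
                              (sym (*-distribˡ-ΣI (β p) (λ m → g (e p) m * f (e m) k)))) ⟩
  ΣI n (λ p → β p * ΣI n (λ m → g (e p) m * f (e m) k))
    ≡⟨ ΣI-cong n (λ p → cong (β p *_) (f-linear (g (e p)) k)) ⟨
  ΣI n (λ p → β p * f (g (e p)) k)
    ∎
  where open ≡-Reasoning

reflection : ∀ {n} → (Vecℤ n → ℤ) → Fin n → Vecℤ n → Vecℤ n
reflection φ i β k = β k - φ β * e i k

module _ {n : ℕ} {φ : Vecℤ n → ℤ} (φ-linear : LinearFunctional φ) (i : Fin n) where

  reflection-linear : Linear (reflection φ i)
  reflection-linear β k = begin
    β k - φ β * e i k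
      ≡⟨ cong₂ (λ x y → x - y * e i k) (id-linear β k) (φ-linear β) ⟩
    ΣI n (λ m → β m * e m k) - ΣI n (λ m → β m * φ (e m)) * e i k
      ≡⟨ cong (λ s → ΣI n (λ m → β m * e m k) - s) (*-distribʳ-ΣI (e i k) (λ m → β m * φ (e m))) ⟩
    ΣI n (λ m → β m * e m k) - ΣI n (λ m → β m * φ (e m) * e i k)
      ≡⟨ ΣI-distrib-- (λ m → β m * e m k) (λ m → β m * φ (e m) * e i k) ⟨
    ΣI n (λ m → β m * e m k - β m * φ (e m) * e i k)
      ≡⟨ ΣI-cong n (λ m → factor (β m) (e m k) (φ (e m)) (e i k)) ⟩
    ΣI n (λ m → β m * (e m k - φ (e m) * e i k))
      ∎
    where
    open ≡-Reasoning
    factor : ∀ b x p y → b * x - b * p * y ≡ b * (x - p * y)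
    factor = solve-∀

  module _ (φ-root : φ (e i) ≡ + 2) where

    φ-reflection : ∀ β → φ (reflection φ i β) ≡ - φ β
    φ-reflection β = begin
      φ (reflection φ i β)                               ≡⟨ φ-linear _ ⟩
      ΣI n (λ m → (β m - φ β * e i m) * φ (e m))         ≡⟨ ΣI-cong n (λ m → expand (β m) (φ β) (e i m) (φ (e m))) ⟩
      ΣI n (λ m → β m * φ (e m) - φ β * (e i m * φ (e m)))
        ≡⟨ ΣI-distrib-- (λ m → β m * φ (e m)) (λ m → φ β * (e i m * φ (e m))) ⟩
      ΣI n (λ m → β m * φ (e m)) - ΣI n (λ m → φ β * (e i m * φ (e m)))
        ≡⟨ cong₂ _-_ (φ-linear β) (*-distribˡ-ΣI (φ β) (λ m → e i m * φ (e m))) ⟨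
      φ β - φ β * ΣI n (λ m → e i m * φ (e m))           ≡⟨ cong (λ s → φ β - φ β * s) (ΣI-selectˡ n i (φ ∘ e)) ⟩
      φ β - φ β * φ (e i)                                ≡⟨ cong (λ s → φ β - φ β * s) φ-root ⟩
      φ β - φ β * + 2                                    ≡⟨ twice (φ β) ⟩
      - φ β                                              ∎
      where
      open ≡-Reasoning
      expand : ∀ b p x q → (b - p * x) * q ≡ b * q - p * (x * q)
      expand = solve-∀
      twice : ∀ p → p - p * + 2 ≡ - p
      twice = solve-∀

    reflection-involutive : ∀ β → reflection φ i (reflection φ i β) ≗ β
    reflection-involutive β k = begin
      (β k - φ β * e i k) - φ (reflection φ i β) * e i k  ≡⟨ cong (λ s → (β k - φ β * e i k) - s * e i k) (φ-reflection β) ⟩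
      (β k - φ β * e i k) - (- φ β) * e i k               ≡⟨ cancel (β k) (φ β) (e i k) ⟩
      β k                                                 ∎
      where
      open ≡-Reasoning
      cancel : ∀ b p x → (b - p * x) - (- p) * x ≡ b
      cancel = solve-∀

    reflection-root : reflection φ i (e i) ≗ (λ k → - e i k)
    reflection-root k = trans (cong (λ s → e i k - s * e i k) φ-root) (flip (e i k))
      where
      flip : ∀ x → x - + 2 * x ≡ - x
      flip = solve-∀

length-∷ʳ : ∀ {a} {X : Set a} (xs : List X) x → length (xs ++ x ∷ []) ≡ suc (length xs)
length-∷ʳ xs x = trans (LP.length-++ xs) (ℕP.+-comm (length xs) 1)

∷ʳ-split : ∀ {a} {X : Set a} (r : List X) j w₁ z w₂ → r ++ j ∷ [] ≡ w₁ ++ z ∷ w₂ →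
  (w₂ ≡ [] × w₁ ≡ r) ⊎ Σ (List X) λ w₂′ → (w₂ ≡ w₂′ ++ j ∷ []) × (r ≡ w₁ ++ z ∷ w₂′)
∷ʳ-split []      j []            z w₂ refl = inj₁ (refl , refl)
∷ʳ-split (a ∷ r) j []            z w₂ refl = inj₂ (r , refl , refl)
∷ʳ-split []      j (b ∷ [])      z w₂ ()
∷ʳ-split []      j (b ∷ c ∷ w₁)  z w₂ ()
∷ʳ-split (a ∷ r) j (b ∷ w₁)      z w₂ eq with LP.∷-injective eq
... | refl , eq′ with ∷ʳ-split r j w₁ z w₂ eq′
...   | inj₁ (refl , refl)         = inj₁ (refl , refl)
...   | inj₂ (w₂′ , refl , r≡)     = inj₂ (w₂′ , refl , cong (a ∷_) r≡)

-- The action of words on the root and coroot lattices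

module WeylGroup {n : ℕ} (A : Matrix n) (A-diag : ∀ i → A i i ≡ + 2) where

  -- sRoot A i and sCoroot A i are definitionally reflection (coroot-pairing i) i and
  -- reflection (root-pairing i) i.
  coroot-pairing : Fin n → Vecℤ n → ℤ
  coroot-pairing i β = ΣI n (λ j → A i j * β j)

  coroot-pairing-linear : ∀ i → LinearFunctional (coroot-pairing i)
  coroot-pairing-linear i β = ΣI-cong n λ m → begin
    A i m * β m                           ≡⟨ ℤP.*-comm (A i m) (β m) ⟩
    β m * A i m                           ≡⟨ cong (β m *_) (ΣI-selectʳ n m (A i)) ⟨
    β m * ΣI n (λ j → A i j * e m j)      ∎
    where open ≡-Reasoning

  root-pairing : Fin n → Vecℤ n → ℤ
  root-pairing i γ = ΣI n (λ j → γ j * A j i)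

  root-pairing-linear : ∀ i → LinearFunctional (root-pairing i)
  root-pairing-linear i γ =
    ΣI-cong n (λ m → cong (γ m *_) (sym (ΣI-selectˡ n m (λ j → A j i))))

  sRoot-linear : ∀ i → Linear (sRoot A i)
  sRoot-linear i = reflection-linear (coroot-pairing-linear i) i

  sRoot-involutive : ∀ i β → sRoot A i (sRoot A i β) ≗ β
  sRoot-involutive i = reflection-involutive (coroot-pairing-linear i) i
    (trans (ΣI-selectʳ n i (A i)) (A-diag i))

  sRoot-root : ∀ i → sRoot A i (e i) ≗ (λ k → - e i k)
  sRoot-root i = reflection-root (coroot-pairing-linear i) i
    (trans (ΣI-selectʳ n i (A i)) (A-diag i))

  sCoroot-root : ∀ i → sCoroot A i (e i) ≗ (λ k → - e i k)
  sCoroot-root i = reflection-root (root-pairing-linear i) i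
    (trans (ΣI-selectˡ n i (λ j → A j i)) (A-diag i))

  act-linear : ∀ w → Linear (act A w)
  act-linear []      = id-linear
  act-linear (i ∷ w) = ∘-linear (reflection-linear (coroot-pairing-linear i) i) (act-linear w)

  coact-linear : ∀ w → Linear (coact A w)
  coact-linear []      = id-linear
  coact-linear (i ∷ w) = ∘-linear (reflection-linear (root-pairing-linear i) i) (coact-linear w)

  act-cong : ∀ w {β γ} → β ≗ γ → act A w β ≗ act A w γ
  act-cong w = linear-cong (act-linear w)

  act-++ : ∀ u v β → act A (u ++ v) β ≡ act A u (act A v β)
  act-++ []      v β = refl
  act-++ (i ∷ u) v β = cong (sRoot A i) (act-++ u v β)

  coact-++ : ∀ u v γ → coact A (u ++ v) γ ≡ coact A u (coact A v γ)
  coact-++ []      v γ = refl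
  coact-++ (i ∷ u) v γ = cong (sCoroot A i) (coact-++ u v γ)

  act-reverse-inverseˡ : ∀ w β → act A (reverse w) (act A w β) ≗ β
  act-reverse-inverseˡ []      β k = refl
  act-reverse-inverseˡ (i ∷ w) β k = begin
    act A (reverse (i ∷ w)) (act A (i ∷ w) β) k
      ≡⟨ cong (λ u → act A u (act A (i ∷ w) β) k) (LP.unfold-reverse i w) ⟩
    act A (reverse w ++ i ∷ []) (act A (i ∷ w) β) k
      ≡⟨ cong (λ γ → γ k) (act-++ (reverse w) (i ∷ []) _) ⟩
    act A (reverse w) (sRoot A i (sRoot A i (act A w β))) k
      ≡⟨ act-cong (reverse w) (sRoot-involutive i _) k ⟩
    act A (reverse w) (act A w β) k
      ≡⟨ act-reverse-inverseˡ w β k ⟩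
    β k ∎
    where open ≡-Reasoning

  act-reverse-inverseʳ : ∀ w β → act A w (act A (reverse w) β) ≗ β
  act-reverse-inverseʳ w β k =
    trans (cong (λ u → act A u (act A (reverse w) β) k) (sym (LP.reverse-involutive w)))
      (act-reverse-inverseˡ (reverse w) β k)

  infix 4 _≈_
  record _≈_ (w w' : Word n) : Set where
    constructor mk≈
    field act-≗ : ∀ β → act A w β ≗ act A w' β
  open _≈_ public

  ≈W⇒≈ : ∀ {w w'} → _≈W_ A w w' → w ≈ w'
  ≈W⇒≈ {w} {w'} w≈w' = mk≈ λ β k → begin
    act A w β k                       ≡⟨ act-linear w β k ⟩
    ΣI n (λ m → β m * act A w (e m) k)  ≡⟨ ΣI-cong n (λ m → cong (β m *_) (w≈w' m k)) ⟩
    ΣI n (λ m → β m * act A w' (e m) k) ≡⟨ act-linear w' β k ⟨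
    act A w' β k                      ∎
    where open ≡-Reasoning

  ≈⇒≈W : ∀ {w w'} → w ≈ w' → _≈W_ A w w'
  ≈⇒≈W w≈w' j = act-≗ w≈w' (e j)

  ≈-refl : ∀ {w} → w ≈ w
  ≈-refl = mk≈ λ β k → refl

  ≈-sym : ∀ {w w'} → w ≈ w' → w' ≈ w
  ≈-sym p = mk≈ λ β k → sym (act-≗ p β k)

  ≈-trans : ∀ {u v w} → u ≈ v → v ≈ w → u ≈ w
  ≈-trans p q = mk≈ λ β k → trans (act-≗ p β k) (act-≗ q β k)

  ≡⇒≈ : ∀ {w w'} → w ≡ w' → w ≈ w'
  ≡⇒≈ refl = ≈-refl

  ≈-setoid : Setoid _ _
  ≈-setoid = record
    { Carrier = Word n ; _≈_ = _≈_
    ; isEquivalence = record { refl = ≈-refl ; sym = ≈-sym ; trans = ≈-trans } }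

  ++-congʳ : ∀ {v v'} u → v ≈ v' → v ++ u ≈ v' ++ u
  ++-congʳ {v} {v'} u p = mk≈ λ β k → begin
    act A (v ++ u) β k          ≡⟨ cong (λ γ → γ k) (act-++ v u β) ⟩
    act A v (act A u β) k       ≡⟨ act-≗ p (act A u β) k ⟩
    act A v' (act A u β) k      ≡⟨ cong (λ γ → γ k) (act-++ v' u β) ⟨
    act A (v' ++ u) β k         ∎
    where open ≡-Reasoning

  ++-congˡ : ∀ u {v v'} → v ≈ v' → u ++ v ≈ u ++ v'
  ++-congˡ u {v} {v'} p = mk≈ λ β k → begin
    act A (u ++ v) β k          ≡⟨ cong (λ γ → γ k) (act-++ u v β) ⟩
    act A u (act A v β) k       ≡⟨ act-cong u (act-≗ p β) k ⟩
    act A u (act A v' β) k      ≡⟨ cong (λ γ → γ k) (act-++ u v' β) ⟨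
    act A (u ++ v') β k         ∎
    where open ≡-Reasoning

  ∷-cong : ∀ i {v v'} → v ≈ v' → i ∷ v ≈ i ∷ v'
  ∷-cong i = ++-congˡ (i ∷ [])

  ∷-involutive : ∀ i w → i ∷ i ∷ w ≈ w
  ∷-involutive i w = mk≈ λ β → sRoot-involutive i (act A w β)

  ∷ʳ-involutive : ∀ w i → (w ++ i ∷ []) ++ i ∷ [] ≈ w
  ∷ʳ-involutive w i = begin
    (w ++ i ∷ []) ++ i ∷ []   ≈⟨ ≡⇒≈ (LP.++-assoc w (i ∷ []) (i ∷ [])) ⟩
    w ++ i ∷ i ∷ []           ≈⟨ ++-congˡ w (∷-involutive i []) ⟩
    w ++ []                   ≈⟨ ≡⇒≈ (LP.++-identityʳ w) ⟩
    w                         ∎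
    where open SetoidReasoning ≈-setoid

  ++-reverseʳ : ∀ w → w ++ reverse w ≈ []
  ++-reverseʳ w = mk≈ λ β k →
    trans (cong (λ γ → γ k) (act-++ w (reverse w) β)) (act-reverse-inverseʳ w β k)

  ++-reverseˡ : ∀ w → reverse w ++ w ≈ []
  ++-reverseˡ w = mk≈ λ β k →
    trans (cong (λ γ → γ k) (act-++ (reverse w) w β)) (act-reverse-inverseˡ w β k)

  reverse-++-cancel : ∀ v w → reverse v ++ v ++ w ≈ w
  reverse-++-cancel v w = ≈-trans (≡⇒≈ (sym (LP.++-assoc (reverse v) v w))) (++-congʳ w (++-reverseˡ v))

  reverse-cong : ∀ {w w'} → w ≈ w' → reverse w ≈ reverse w'
  reverse-cong {w} {w'} p = mk≈ λ β k → begin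
    act A (reverse w) β k
      ≡⟨ act-cong (reverse w) (λ l → sym (act-reverse-inverseʳ w' β l)) k ⟩
    act A (reverse w) (act A w' (act A (reverse w') β)) k
      ≡⟨ act-cong (reverse w) (λ l → sym (act-≗ p (act A (reverse w') β) l)) k ⟩
    act A (reverse w) (act A w (act A (reverse w') β)) k
      ≡⟨ act-reverse-inverseˡ w _ k ⟩
    act A (reverse w') β k ∎
    where open ≡-Reasoning

-- The length function

module Length {n : ℕ} (A : Matrix n) (A-diag : ∀ i → A i i ≡ + 2)
               (ℓ : Word n → ℕ) (isLength : IsLength A ℓ) where
  open WeylGroup A A-diag

  reduced-word : ∀ w → Σ (Word n) λ r → (r ≈ w) × (length r ≡ ℓ w)
  reduced-word w with proj₁ (isLength w)
  ... | r , r≈w , |r| = r , ≈W⇒≈ r≈w , |r|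

  ℓ-minimal : ∀ {w} w' → w' ≈ w → ℓ w ℕ.≤ length w'
  ℓ-minimal {w} w' w'≈w = proj₂ (isLength w) w' (≈⇒≈W w'≈w)

  ℓ≤length : ∀ w → ℓ w ℕ.≤ length w
  ℓ≤length w = ℓ-minimal w ≈-refl

  ℓ-cong : ∀ {w w'} → w ≈ w' → ℓ w ≡ ℓ w'
  ℓ-cong p = ℕP.≤-antisym (ℓ-≥ (≈-sym p)) (ℓ-≥ p)
    where
    ℓ-≥ : ∀ {w w'} → w ≈ w' → ℓ w' ℕ.≤ ℓ w
    ℓ-≥ {w} p with reduced-word w
    ... | r , r≈w , |r| = subst (_ ℕ.≤_) |r| (ℓ-minimal r (≈-trans r≈w p))

  ℓ-++ : ∀ u v → ℓ (u ++ v) ℕ.≤ ℓ u ℕ.+ ℓ v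
  ℓ-++ u v with reduced-word u | reduced-word v
  ... | r , r≈u , |r| | t , t≈v , |t| =
    subst (_ ℕ.≤_) (trans (LP.length-++ r) (cong₂ ℕ._+_ |r| |t|))
      (ℓ-minimal (r ++ t) (≈-trans (++-congʳ t r≈u) (++-congˡ u t≈v)))

  ℓ≡0⇒≈[] : ∀ w → ℓ w ≡ 0 → w ≈ []
  ℓ≡0⇒≈[] w ℓw≡0 with reduced-word w
  ... | []    , r≈w , _   = ≈-sym r≈w
  ... | _ ∷ _ , _   , |r| with () ← trans |r| ℓw≡0

  ℓ-[] : ℓ [] ≡ 0
  ℓ-[] = ℕP.n≤0⇒n≡0 (ℓ≤length [])

  ℓ-reverse-≤ : ∀ w → ℓ (reverse w) ℕ.≤ ℓ w
  ℓ-reverse-≤ w with reduced-word w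
  ... | r , r≈w , |r| = subst (_ ℕ.≤_) (trans (LP.length-reverse r) |r|)
    (ℓ-minimal (reverse r) (reverse-cong r≈w))

  ℓ-reverse : ∀ w → ℓ (reverse w) ≡ ℓ w
  ℓ-reverse w = ℕP.≤-antisym (ℓ-reverse-≤ w)
    (subst (λ u → ℓ u ℕ.≤ ℓ (reverse w)) (LP.reverse-involutive w) (ℓ-reverse-≤ (reverse w)))

  ℓ-generator : ∀ i → ℓ (i ∷ []) ≡ 1
  ℓ-generator i = ℕP.≤-antisym (ℓ≤length (i ∷ [])) (ℕP.n≢0⇒n>0 ℓ≢0)
    where
    ℓ≢0 : ℓ (i ∷ []) ≢ 0
    ℓ≢0 ℓ≡0 with begin
        -[1+ 0 ]            ≡⟨ cong -_ (e-diag i) ⟨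
        - e i i             ≡⟨ sRoot-root i i ⟨
        sRoot A i (e i) i   ≡⟨ act-≗ (ℓ≡0⇒≈[] (i ∷ []) ℓ≡0) (e i) i ⟩
        e i i               ≡⟨ e-diag i ⟩
        1ℤ                  ∎
      where open ≡-Reasoning
    ... | ()

  ℓ-∷-≤ : ∀ i w → ℓ (i ∷ w) ℕ.≤ suc (ℓ w)
  ℓ-∷-≤ i w = subst (ℓ (i ∷ w) ℕ.≤_) (cong (ℕ._+ ℓ w) (ℓ-generator i)) (ℓ-++ (i ∷ []) w)

  ℓ-∷-≥ : ∀ i w → ℓ w ℕ.≤ suc (ℓ (i ∷ w))
  ℓ-∷-≥ i w = subst (ℕ._≤ suc (ℓ (i ∷ w))) (ℓ-cong (∷-involutive i w)) (ℓ-∷-≤ i (i ∷ w))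

  ℓ-∷ʳ-≤ : ∀ w i → ℓ (w ++ i ∷ []) ℕ.≤ suc (ℓ w)
  ℓ-∷ʳ-≤ w i = subst (ℓ (w ++ i ∷ []) ℕ.≤_) (trans (cong (ℓ w ℕ.+_) (ℓ-generator i)) (ℕP.+-comm (ℓ w) 1))
    (ℓ-++ w (i ∷ []))

  ℓ-∷ʳ-≥ : ∀ w i → ℓ w ℕ.≤ suc (ℓ (w ++ i ∷ []))
  ℓ-∷ʳ-≥ w i = subst (ℕ._≤ suc (ℓ (w ++ i ∷ []))) (ℓ-cong (∷ʳ-involutive w i)) (ℓ-∷ʳ-≤ (w ++ i ∷ []) i)

-- Rank two arithmetic

halving-invariant : ∀ X Y c d → 4 ℕ.≤ X ℕ.* Y → 2 ℕ.* c ℕ.≤ X ℕ.* d →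
  c ℕ.≤ X ℕ.* d × 2 ℕ.* d ℕ.≤ Y ℕ.* (X ℕ.* d ℕ.∸ c)
halving-invariant X Y c d 4≤XY 2c≤Xd = c≤Xd ,
  subst (2 ℕ.* d ℕ.≤_) (sym (ℕP.*-distribˡ-∸ Y (X ℕ.* d) c))
    (ℕP.m+n≤o⇒m≤o∸n (2 ℕ.* d) (ℕP.*-cancelˡ-≤ 2 doubled))
  where
  c≤Xd : c ℕ.≤ X ℕ.* d
  c≤Xd = ℕP.≤-trans (ℕP.m≤m+n c (c ℕ.+ 0)) 2c≤Xd
  expand : ∀ d Y c → 2 ℕ.* (2 ℕ.* d ℕ.+ Y ℕ.* c) ≡ 4 ℕ.* d ℕ.+ Y ℕ.* (2 ℕ.* c)
  expand = ℕ-solve-∀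
  collect : ∀ X Y d → X ℕ.* Y ℕ.* d ℕ.+ Y ℕ.* (X ℕ.* d) ≡ 2 ℕ.* (Y ℕ.* (X ℕ.* d))
  collect = ℕ-solve-∀
  doubled : 2 ℕ.* (2 ℕ.* d ℕ.+ Y ℕ.* c) ℕ.≤ 2 ℕ.* (Y ℕ.* (X ℕ.* d))
  doubled = subst₂ ℕ._≤_ (sym (expand d Y c)) (collect X Y d)
    (ℕP.+-mono-≤ (ℕP.*-monoˡ-≤ d 4≤XY) (ℕP.*-monoʳ-≤ Y 2c≤Xd))

reflected-coordinate : ∀ Z c d → c ℕ.≤ Z ℕ.* d → + Z * + d - + c - 0ℤ ≡ + (Z ℕ.* d ℕ.∸ c)
reflected-coordinate Z c d c≤Zd = begin
  + Z * + d - + c - 0ℤ   ≡⟨ minus-zero (+ Z * + d - + c) ⟩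
  + Z * + d - + c        ≡⟨ cong (_- + c) (ℤP.pos-* Z d) ⟨
  + (Z ℕ.* d) - + c      ≡⟨ ℤP.m-n≡m⊖n (Z ℕ.* d) c ⟩
  Z ℕ.* d ⊖ c            ≡⟨ ℤP.⊖-≥ c≤Zd ⟩
  + (Z ℕ.* d ℕ.∸ c)      ∎
  where
  open ≡-Reasoning
  minus-zero : ∀ x → x - 0ℤ ≡ x
  minus-zero = solve-∀

-- Coordinates (c , d) of β + c α_s + d α_s′ under the simple reflections s, s′ of a Cartan
-- matrix with A s s′ = - X and A s′ s = - Y, where P = ⟨α_s^∨, β⟩ and Q = ⟨α_s′^∨, β⟩.
module Rank2 (X Y : ℕ) where

  step : ℤ → ℤ → Bool → ℤ × ℤ → ℤ × ℤ
  step P Q true  (c , d) = (+ X * d - c - P , d)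
  step P Q false (c , d) = (c , + Y * c - d - Q)

  run : ℤ → ℤ → Bool → ℕ → ℤ × ℤ → ℤ × ℤ
  run P Q b zero    cd = cd
  run P Q b (suc m) cd = run P Q (not b) m (step P Q b cd)

  infixl 6 _⊕_
  infixl 7 _⊙_

  _⊕_ : ℤ × ℤ → ℤ × ℤ → ℤ × ℤ
  (a , b) ⊕ (c , d) = (a + c , b + d)

  _⊙_ : ℤ → ℤ × ℤ → ℤ × ℤ
  k ⊙ (a , b) = (k * a , k * b)

  step-linear : ∀ b P Q P′ Q′ u v cd cd′ →
    step (u * P + v * P′) (u * Q + v * Q′) b (u ⊙ cd ⊕ v ⊙ cd′)
      ≡ u ⊙ step P Q b cd ⊕ v ⊙ step P′ Q′ b cd′
  step-linear true  P Q P′ Q′ u v (c , d) (c′ , d′) =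
    cong (_, u * d + v * d′) (reflect (+ X) u v c c′ d d′ P P′)
    where
    reflect : ∀ x u v c c′ d d′ P P′ →
      x * (u * d + v * d′) - (u * c + v * c′) - (u * P + v * P′)
        ≡ u * (x * d - c - P) + v * (x * d′ - c′ - P′)
    reflect = solve-∀
  step-linear false P Q P′ Q′ u v (c , d) (c′ , d′) =
    cong (u * c + v * c′ ,_) (reflect (+ Y) u v d d′ c c′ Q Q′)
    where
    reflect : ∀ y u v d d′ c c′ Q Q′ →
      y * (u * c + v * c′) - (u * d + v * d′) - (u * Q + v * Q′)
        ≡ u * (y * c - d - Q) + v * (y * c′ - d′ - Q′)
    reflect = solve-∀

  run-linear : ∀ b m P Q P′ Q′ u v cd cd′ →
    run (u * P + v * P′) (u * Q + v * Q′) b m (u ⊙ cd ⊕ v ⊙ cd′)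
      ≡ u ⊙ run P Q b m cd ⊕ v ⊙ run P′ Q′ b m cd′
  run-linear b zero    P Q P′ Q′ u v cd cd′ = refl
  run-linear b (suc m) P Q P′ Q′ u v cd cd′ =
    trans (cong (run (u * P + v * P′) (u * Q + v * Q′) (not b) m) (step-linear b P Q P′ Q′ u v cd cd′))
      (run-linear (not b) m P Q P′ Q′ u v (step P Q b cd) (step P′ Q′ b cd′))

  run-origin : ∀ b m P Q →
    run P Q b m (0ℤ , 0ℤ) ≡ P ⊙ run 1ℤ 0ℤ b m (0ℤ , 0ℤ) ⊕ Q ⊙ run 0ℤ 1ℤ b m (0ℤ , 0ℤ)
  run-origin b m P Q = begin
    run P Q b m (0ℤ , 0ℤ)
      ≡⟨ cong₂ (λ P′ Q′ → run P′ Q′ b m (0ℤ , 0ℤ)) (first P Q) (second P Q) ⟩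
    run (P * 1ℤ + Q * 0ℤ) (P * 0ℤ + Q * 1ℤ) b m (0ℤ , 0ℤ)
      ≡⟨ cong (run (P * 1ℤ + Q * 0ℤ) (P * 0ℤ + Q * 1ℤ) b m) (cong₂ _,_ (origin P Q) (origin P Q)) ⟩
    run (P * 1ℤ + Q * 0ℤ) (P * 0ℤ + Q * 1ℤ) b m (P ⊙ (0ℤ , 0ℤ) ⊕ Q ⊙ (0ℤ , 0ℤ))
      ≡⟨ run-linear b m 1ℤ 0ℤ 0ℤ 1ℤ P Q (0ℤ , 0ℤ) (0ℤ , 0ℤ) ⟩
    P ⊙ run 1ℤ 0ℤ b m (0ℤ , 0ℤ) ⊕ Q ⊙ run 0ℤ 1ℤ b m (0ℤ , 0ℤ)
      ∎
    where
    open ≡-Reasoning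
    first : ∀ P Q → P ≡ P * 1ℤ + Q * 0ℤ
    first = solve-∀
    second : ∀ P Q → Q ≡ P * 0ℤ + Q * 1ℤ
    second = solve-∀
    origin : ∀ P Q → 0ℤ ≡ P * 0ℤ + Q * 0ℤ
    origin = solve-∀

  NonNeg : ℤ × ℤ → Set
  NonNeg (c , d) = 0ℤ ℤ.≤ c × 0ℤ ℤ.≤ d

  nonNeg? : ∀ cd → Dec (NonNeg cd)
  nonNeg? (c , d) = (0ℤ ℤ.≤? c) ×-dec (0ℤ ℤ.≤? d)

  -- For 4 ≤ X * Y this invariant keeps the coordinates in ℕ along any alternating word.
  Halving : Bool → ℕ → ℕ → Set
  Halving true  c d = 2 ℕ.* c ℕ.≤ X ℕ.* d
  Halving false c d = 2 ℕ.* d ℕ.≤ Y ℕ.* c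

  step-true-ℕ : ∀ c d → c ℕ.≤ X ℕ.* d → step 0ℤ 0ℤ true (+ c , + d) ≡ (+ (X ℕ.* d ℕ.∸ c) , + d)
  step-true-ℕ c d c≤Xd = cong (_, + d) (reflected-coordinate X c d c≤Xd)

  step-false-ℕ : ∀ c d → d ℕ.≤ Y ℕ.* c → step 0ℤ 0ℤ false (+ c , + d) ≡ (+ c , + (Y ℕ.* c ℕ.∸ d))
  step-false-ℕ c d d≤Yc = cong (+ c ,_) (reflected-coordinate Y d c d≤Yc)

  run-halving : 4 ℕ.≤ X ℕ.* Y → ∀ m b c d → Halving b c d →
    Σ ℕ λ c′ → Σ ℕ λ d′ → run 0ℤ 0ℤ b m (+ c , + d) ≡ (+ c′ , + d′)
  run-halving 4≤XY zero    b     c d _ = c , d , refl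
  run-halving 4≤XY (suc m) true  c d h with halving-invariant X Y c d 4≤XY h
  ... | c≤Xd , h′ = subst (λ cd → Σ ℕ λ c′ → Σ ℕ λ d′ → run 0ℤ 0ℤ false m cd ≡ (+ c′ , + d′))
    (sym (step-true-ℕ c d c≤Xd)) (run-halving 4≤XY m false (X ℕ.* d ℕ.∸ c) d h′)
  run-halving 4≤XY (suc m) false c d h with halving-invariant Y X d c (subst (4 ℕ.≤_) (ℕP.*-comm X Y) 4≤XY) h
  ... | d≤Yc , h′ = subst (λ cd → Σ ℕ λ c′ → Σ ℕ λ d′ → run 0ℤ 0ℤ true m cd ≡ (+ c′ , + d′))
    (sym (step-false-ℕ c d d≤Yc)) (run-halving 4≤XY m true c (Y ℕ.* c ℕ.∸ d) h′)

  run-nonneg-infinite : 4 ℕ.≤ X ℕ.* Y → ∀ m → NonNeg (run 0ℤ 0ℤ false m (1ℤ , 0ℤ))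
  run-nonneg-infinite 4≤XY m with run-halving 4≤XY m false 1 0 z≤n
  ... | c′ , d′ , eq rewrite eq = ℤ.+≤+ z≤n , ℤ.+≤+ z≤n

-- Dihedral subgroups

module Dihedral {n : ℕ} (A : Matrix n) (A-diag : ∀ i → A i i ≡ + 2) (s s′ : Fin n) where
  open WeylGroup A A-diag

  letter : Bool → Fin n
  letter true  = s
  letter false = s′

  alternating : Bool → ℕ → Word n
  alternating b zero    = []
  alternating b (suc m) = alternating (not b) m ++ letter b ∷ []

  InPair : Fin n → Set
  InPair i = i ≡ s ⊎ i ≡ s′

  letter-InPair : ∀ b → InPair (letter b)
  letter-InPair true  = inj₁ refl
  letter-InPair false = inj₂ refl

  alternating-InPair : ∀ b m → All InPair (alternating b m)
  alternating-InPair b zero    = []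
  alternating-InPair b (suc m) = AllP.++⁺ (alternating-InPair (not b) m) (letter-InPair b ∷ [])

  length-alternating : ∀ b m → length (alternating b m) ≡ m
  length-alternating b zero    = refl
  length-alternating b (suc m) = trans (length-∷ʳ (alternating (not b) m) (letter b))
    (cong suc (length-alternating (not b) m))

  alternating-suffix : ∀ b j d → Σ (Word n) λ u → alternating b (j ℕ.+ d) ≡ u ++ alternating b j
  alternating-suffix b zero    d = alternating b d , sym (LP.++-identityʳ (alternating b d))
  alternating-suffix b (suc j) d with alternating-suffix (not b) j d
  ... | u , eq = u , trans (cong (_++ letter b ∷ []) eq) (LP.++-assoc u (alternating (not b) j) (letter b ∷ []))

  NonNegOnPair : Vecℤ n → Set
  NonNegOnPair β = Σ ℤ λ c → Σ ℤ λ d → 0ℤ ℤ.≤ c × 0ℤ ℤ.≤ d × β ≗ (λ k → c * e s k + d * e s′ k)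

  embed : Vecℤ n → ℤ × ℤ → Vecℤ n
  embed β (c , d) k = β k + (c * e s k + d * e s′ k)

  module Coordinates (X Y : ℕ) (A-ss′ : A s s′ ≡ - + X) (A-s′s : A s′ s ≡ - + Y) where
    open Rank2 X Y

    coroot-pairing-embed : ∀ i β c d →
      coroot-pairing i (embed β (c , d)) ≡ coroot-pairing i β + (c * A i s + d * A i s′)
    coroot-pairing-embed i β c d = begin
      ΣI n (λ j → A i j * (β j + (c * e s j + d * e s′ j)))
        ≡⟨ ΣI-cong n (λ j → expand (A i j) (β j) c (e s j) d (e s′ j)) ⟩
      ΣI n (λ j → A i j * β j + (c * (A i j * e s j) + d * (A i j * e s′ j)))
        ≡⟨ ΣI-distrib-+ (λ j → A i j * β j) (λ j → c * (A i j * e s j) + d * (A i j * e s′ j)) ⟩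
      coroot-pairing i β + ΣI n (λ j → c * (A i j * e s j) + d * (A i j * e s′ j))
        ≡⟨ cong (λ z → coroot-pairing i β + z)
             (ΣI-distrib-+ (λ j → c * (A i j * e s j)) (λ j → d * (A i j * e s′ j))) ⟩
      coroot-pairing i β + (ΣI n (λ j → c * (A i j * e s j)) + ΣI n (λ j → d * (A i j * e s′ j)))
        ≡⟨ cong (λ z → coroot-pairing i β + z)
             (cong₂ _+_ (*-distribˡ-ΣI c (λ j → A i j * e s j)) (*-distribˡ-ΣI d (λ j → A i j * e s′ j))) ⟨
      coroot-pairing i β + (c * ΣI n (λ j → A i j * e s j) + d * ΣI n (λ j → A i j * e s′ j))
        ≡⟨ cong (λ z → coroot-pairing i β + z)
             (cong₂ (λ x y → c * x + d * y) (ΣI-selectʳ n s (A i)) (ΣI-selectʳ n s′ (A i))) ⟩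
      coroot-pairing i β + (c * A i s + d * A i s′)
        ∎
      where
      open ≡-Reasoning
      expand : ∀ a b c x d y → a * (b + (c * x + d * y)) ≡ a * b + (c * (a * x) + d * (a * y))
      expand = solve-∀

    sRoot-embed : ∀ b β cd →
      sRoot A (letter b) (embed β cd) ≗ embed β (step (coroot-pairing s β) (coroot-pairing s′ β) b cd)
    sRoot-embed true β (c , d) k = begin
      embed β (c , d) k - coroot-pairing s (embed β (c , d)) * e s k
        ≡⟨ cong (λ z → embed β (c , d) k - z * e s k)
             (trans (coroot-pairing-embed s β c d) (cong₂ (λ x y → P + (c * x + d * y)) (A-diag s) A-ss′)) ⟩
      β k + (c * e s k + d * e s′ k) - (P + (c * + 2 + d * - + X)) * e s k
        ≡⟨ reflect (β k) c (e s k) d (e s′ k) P (+ X) ⟩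
      β k + ((+ X * d - c - P) * e s k + d * e s′ k)
        ∎
      where
      open ≡-Reasoning
      P : ℤ
      P = coroot-pairing s β
      reflect : ∀ b c x d y P X → b + (c * x + d * y) - (P + (c * + 2 + d * - X)) * x ≡ b + ((X * d - c - P) * x + d * y)
      reflect = solve-∀
    sRoot-embed false β (c , d) k = begin
      embed β (c , d) k - coroot-pairing s′ (embed β (c , d)) * e s′ k
        ≡⟨ cong (λ z → embed β (c , d) k - z * e s′ k)
             (trans (coroot-pairing-embed s′ β c d) (cong₂ (λ x y → Q + (c * x + d * y)) A-s′s (A-diag s′))) ⟩
      β k + (c * e s k + d * e s′ k) - (Q + (c * - + Y + d * + 2)) * e s′ k
        ≡⟨ reflect (β k) c (e s k) d (e s′ k) Q (+ Y) ⟩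
      β k + (c * e s k + (+ Y * c - d - Q) * e s′ k)
        ∎
      where
      open ≡-Reasoning
      Q : ℤ
      Q = coroot-pairing s′ β
      reflect : ∀ b c x d y Q Y → b + (c * x + d * y) - (Q + (c * - Y + d * + 2)) * y ≡ b + (c * x + (Y * c - d - Q) * y)
      reflect = solve-∀

    act-alternating-embed : ∀ b m β cd → act A (alternating b m) (embed β cd)
      ≗ embed β (run (coroot-pairing s β) (coroot-pairing s′ β) b m cd)
    act-alternating-embed b zero    β cd k = refl
    act-alternating-embed b (suc m) β cd k = begin
      act A (alternating (not b) m ++ letter b ∷ []) (embed β cd) k
        ≡⟨ cong (λ γ → γ k) (act-++ (alternating (not b) m) (letter b ∷ []) (embed β cd)) ⟩
      act A (alternating (not b) m) (sRoot A (letter b) (embed β cd)) k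
        ≡⟨ act-cong (alternating (not b) m) (sRoot-embed b β cd) k ⟩
      act A (alternating (not b) m) (embed β (step P Q b cd)) k
        ≡⟨ act-alternating-embed (not b) m β (step P Q b cd) k ⟩
      embed β (run P Q b (suc m) cd) k
        ∎
      where
      open ≡-Reasoning
      P : ℤ
      P = coroot-pairing s β
      Q : ℤ
      Q = coroot-pairing s′ β

    alternating-braid : ∀ b m b′ m′ →
      run 1ℤ 0ℤ b m (0ℤ , 0ℤ) ≡ run 1ℤ 0ℤ b′ m′ (0ℤ , 0ℤ) →
      run 0ℤ 1ℤ b m (0ℤ , 0ℤ) ≡ run 0ℤ 1ℤ b′ m′ (0ℤ , 0ℤ) →
      alternating b m ≈ alternating b′ m′
    alternating-braid b m b′ m′ eq₁ eq₂ = ≈W⇒≈ λ j k → begin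
      act A (alternating b m) (e j) k
        ≡⟨ act-cong (alternating b m) (embed-origin j) k ⟩
      act A (alternating b m) (embed (e j) (0ℤ , 0ℤ)) k
        ≡⟨ act-alternating-embed b m (e j) (0ℤ , 0ℤ) k ⟩
      embed (e j) (run (P j) (Q j) b m (0ℤ , 0ℤ)) k
        ≡⟨ cong (λ cd → embed (e j) cd k) (run-origin b m (P j) (Q j)) ⟩
      embed (e j) (P j ⊙ run 1ℤ 0ℤ b m (0ℤ , 0ℤ) ⊕ Q j ⊙ run 0ℤ 1ℤ b m (0ℤ , 0ℤ)) k
        ≡⟨ cong₂ (λ x y → embed (e j) (P j ⊙ x ⊕ Q j ⊙ y) k) eq₁ eq₂ ⟩
      embed (e j) (P j ⊙ run 1ℤ 0ℤ b′ m′ (0ℤ , 0ℤ) ⊕ Q j ⊙ run 0ℤ 1ℤ b′ m′ (0ℤ , 0ℤ)) k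
        ≡⟨ cong (λ cd → embed (e j) cd k) (run-origin b′ m′ (P j) (Q j)) ⟨
      embed (e j) (run (P j) (Q j) b′ m′ (0ℤ , 0ℤ)) k
        ≡⟨ act-alternating-embed b′ m′ (e j) (0ℤ , 0ℤ) k ⟨
      act A (alternating b′ m′) (embed (e j) (0ℤ , 0ℤ)) k
        ≡⟨ act-cong (alternating b′ m′) (embed-origin j) k ⟨
      act A (alternating b′ m′) (e j) k
        ∎
      where
      open ≡-Reasoning
      P Q : Fin n → ℤ
      P j = coroot-pairing s (e j)
      Q j = coroot-pairing s′ (e j)
      embed-origin : ∀ j → e j ≗ embed (e j) (0ℤ , 0ℤ)
      embed-origin j k = add-zeros (e j k) (e s k) (e s′ k)
        where
        add-zeros : ∀ a x y → a ≡ a + (0ℤ * x + 0ℤ * y)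
        add-zeros = solve-∀

    alternating-root : ∀ m → NonNeg (run 0ℤ 0ℤ false m (1ℤ , 0ℤ)) →
      NonNegOnPair (act A (alternating false m) (e s))
    alternating-root m nonneg with run 0ℤ 0ℤ false m (1ℤ , 0ℤ) in eq
    ... | c , d = c , d , proj₁ nonneg , proj₂ nonneg , λ k → begin
      act A (alternating false m) (e s) k
        ≡⟨ act-cong (alternating false m) root-embed k ⟩
      act A (alternating false m) (embed zero-vector (1ℤ , 0ℤ)) k
        ≡⟨ act-alternating-embed false m zero-vector (1ℤ , 0ℤ) k ⟩
      embed zero-vector (run (coroot-pairing s zero-vector) (coroot-pairing s′ zero-vector) false m (1ℤ , 0ℤ)) k
        ≡⟨ cong₂ (λ P Q → embed zero-vector (run P Q false m (1ℤ , 0ℤ)) k) (pairing-zero s) (pairing-zero s′) ⟩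
      embed zero-vector (run 0ℤ 0ℤ false m (1ℤ , 0ℤ)) k
        ≡⟨ cong (λ cd → embed zero-vector cd k) eq ⟩
      0ℤ + (c * e s k + d * e s′ k)
        ≡⟨ ℤP.+-identityˡ _ ⟩
      c * e s k + d * e s′ k
        ∎
      where
      open ≡-Reasoning
      zero-vector : Vecℤ n
      zero-vector _ = 0ℤ
      pairing-zero : ∀ i → coroot-pairing i zero-vector ≡ 0ℤ
      pairing-zero i = trans (ΣI-cong n (λ j → ℤP.*-zeroʳ (A i j))) (ΣI-zero n)
      root-embed : e s ≗ embed zero-vector (1ℤ , 0ℤ)
      root-embed k = as-combination (e s k) (e s′ k)
        where
        as-combination : ∀ x y → x ≡ 0ℤ + (1ℤ * x + 0ℤ * y)
        as-combination = solve-∀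

  Reduced : Word n → Set
  Reduced p = ∀ q → q ≈ p → length p ℕ.≤ length q

  RightAscent : Word n → Set
  RightAscent p = ∀ q → All InPair q → q ≈ p ++ s ∷ [] → length p ℕ.≤ length q

  other-letter : ∀ b {i} → InPair i → i ≢ letter b → i ≡ letter (not b)
  other-letter true  (inj₁ refl) i≢s  = ⊥-elim (i≢s refl)
  other-letter true  (inj₂ refl) _    = refl
  other-letter false (inj₁ refl) _    = refl
  other-letter false (inj₂ refl) i≢s′ = ⊥-elim (i≢s′ refl)

  reduced-∷ʳ⁻ : ∀ p i → Reduced (p ++ i ∷ []) → Reduced p
  reduced-∷ʳ⁻ p i red q q≈p = ℕP.≤-pred (subst₂ ℕ._≤_ (length-∷ʳ p i) (length-∷ʳ q i)
    (red (q ++ i ∷ []) (++-congʳ (i ∷ []) q≈p)))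

  reduced-alternating : ∀ p → All InPair p → Reduced p →
    p ≡ [] ⊎ Σ Bool λ b → Σ ℕ λ m → p ≡ alternating b (suc m)
  reduced-alternating p = go p (reverseView p)
    where
    go : ∀ p → Reverse p → All InPair p → Reduced p →
      p ≡ [] ⊎ Σ Bool λ b → Σ ℕ λ m → p ≡ alternating b (suc m)
    go .[] [] _ _ = inj₁ refl
    go .(p ++ i ∷ []) (p ∶ p-view ∶ʳ i) pi-pair pi-red with AllP.∷ʳ⁻ pi-pair
    ... | p-pair , i-pair with go p p-view p-pair (reduced-∷ʳ⁻ p i pi-red) | i-pair
    ...   | inj₁ refl | inj₁ refl = inj₂ (true , 0 , refl)
    ...   | inj₁ refl | inj₂ refl = inj₂ (false , 0 , refl)
    ...   | inj₂ (b , m , refl) | _ with i Fin.≟ letter b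
    ...     | yes refl = ⊥-elim (ℕP.<⇒≱ shorter (pi-red (alternating (not b) m)
                           (≈-sym (∷ʳ-involutive (alternating (not b) m) (letter b)))))
      where
      shorter : length (alternating (not b) m) ℕ.< length (alternating b (suc m) ++ letter b ∷ [])
      shorter = subst₂ ℕ._<_ (sym (length-alternating (not b) m))
        (sym (trans (length-∷ʳ (alternating b (suc m)) (letter b)) (cong suc (length-alternating b (suc m)))))
        (ℕP.m<n⇒m<1+n (ℕP.n<1+n m))
    ...     | no i≢b with b | other-letter b i-pair i≢b
    ...       | true  | refl = inj₂ (false , suc m , refl)
    ...       | false | refl = inj₂ (true  , suc m , refl)

  module FiniteType (X Y : ℕ) (A-ss′ : A s s′ ≡ - + X) (A-s′s : A s′ s ≡ - + Y) (k : ℕ) where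
    open Rank2 X Y
    open Coordinates X Y A-ss′ A-s′s

    -- eq₁ and eq₂ give the braid relation alternating true (2 + k) ≈ alternating false k, so an
    -- alternating word with a right ascent has length at most k; those are checked by evaluation.
    finite-type :
      run 1ℤ 0ℤ true (2 ℕ.+ k) (0ℤ , 0ℤ) ≡ run 1ℤ 0ℤ false k (0ℤ , 0ℤ) →
      run 0ℤ 1ℤ true (2 ℕ.+ k) (0ℤ , 0ℤ) ≡ run 0ℤ 1ℤ false k (0ℤ , 0ℤ) →
      True (FinP.all? λ (m : Fin (suc k)) → nonNeg? (run 0ℤ 0ℤ false (Fin.toℕ m) (1ℤ , 0ℤ))) →
      ∀ m → RightAscent (alternating false m) → NonNegOnPair (act A (alternating false m) (e s))
    finite-type eq₁ eq₂ checks m ascent with m ℕ.<? suc k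
    ... | yes m≤k = alternating-root m
      (subst (λ j → NonNeg (run 0ℤ 0ℤ false j (1ℤ , 0ℤ))) (FinP.toℕ-fromℕ< m≤k)
        (toWitness checks (Fin.fromℕ< m≤k)))
    ... | no m≰k = ⊥-elim (ℕP.<⇒≱ shorter (ascent (u ++ alternating false k) q-pair q≈))
      where
      m≡ : 2 ℕ.+ k ℕ.+ (m ℕ.∸ suc k) ≡ suc m
      m≡ = cong suc (ℕP.m+[n∸m]≡n (ℕP.≮⇒≥ m≰k))
      u : Word n
      u = proj₁ (alternating-suffix true (2 ℕ.+ k) (m ℕ.∸ suc k))
      split : alternating true (suc m) ≡ u ++ alternating true (2 ℕ.+ k)
      split = trans (cong (alternating true) (sym m≡)) (proj₂ (alternating-suffix true (2 ℕ.+ k) (m ℕ.∸ suc k)))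
      q-pair : All InPair (u ++ alternating false k)
      q-pair = AllP.++⁺ (AllP.++⁻ˡ u (subst (All InPair) split (alternating-InPair true (suc m))))
        (alternating-InPair false k)
      q≈ : u ++ alternating false k ≈ alternating false m ++ s ∷ []
      q≈ = ≈-trans (++-congˡ u (≈-sym (alternating-braid true (2 ℕ.+ k) false k eq₁ eq₂))) (≡⇒≈ (sym split))
      lengths : suc (suc (length u ℕ.+ k)) ≡ suc m
      lengths = begin
        suc (suc (length u ℕ.+ k))                    ≡⟨ trans (ℕP.+-suc (length u) (suc k)) (cong suc (ℕP.+-suc (length u) k)) ⟨
        length u ℕ.+ (2 ℕ.+ k)                        ≡⟨ cong (length u ℕ.+_) (length-alternating true (2 ℕ.+ k)) ⟨
        length u ℕ.+ length (alternating true (2 ℕ.+ k)) ≡⟨ LP.length-++ u ⟨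
        length (u ++ alternating true (2 ℕ.+ k))      ≡⟨ cong length split ⟨
        length (alternating true (suc m))             ≡⟨ length-alternating true (suc m) ⟩
        suc m                                         ∎
        where open ≡-Reasoning
      shorter : length (u ++ alternating false k) ℕ.< length (alternating false m)
      shorter = subst₂ ℕ._<_
        (sym (trans (LP.length-++ u) (cong (length u ℕ.+_) (length-alternating false k))))
        (sym (length-alternating false m))
        (ℕP.≤-reflexive (ℕP.suc-injective lengths))

  nonpositive : ∀ z → z ℤ.≤ 0ℤ → Σ ℕ λ X → z ≡ - + X
  nonpositive (+ zero)   _ = 0 , refl
  nonpositive -[1+ k ]   _ = suc k , refl
  nonpositive (+ suc k)  (ℤ.+≤+ ())

  module _ (gcm : IsGCM A) (s≢s′ : s ≢ s′) where

    private
      A-zero-sym : ∀ i j → A i j ≡ 0ℤ → A j i ≡ 0ℤ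
      A-zero-sym = proj₂ (proj₂ gcm)

    finite-types : ∀ X Y → A s s′ ≡ - + X → A s′ s ≡ - + Y → ¬ 4 ℕ.≤ X ℕ.* Y →
      ∀ m → RightAscent (alternating false m) → NonNegOnPair (act A (alternating false m) (e s))
    finite-types 0 0 A-ss′ A-s′s _ = FiniteType.finite-type 0 0 A-ss′ A-s′s 1 refl refl _
    finite-types 1 1 A-ss′ A-s′s _ = FiniteType.finite-type 1 1 A-ss′ A-s′s 2 refl refl _
    finite-types 1 2 A-ss′ A-s′s _ = FiniteType.finite-type 1 2 A-ss′ A-s′s 3 refl refl _
    finite-types 2 1 A-ss′ A-s′s _ = FiniteType.finite-type 2 1 A-ss′ A-s′s 3 refl refl _
    finite-types 1 3 A-ss′ A-s′s _ = FiniteType.finite-type 1 3 A-ss′ A-s′s 5 refl refl _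
    finite-types 3 1 A-ss′ A-s′s _ = FiniteType.finite-type 3 1 A-ss′ A-s′s 5 refl refl _
    finite-types 0 (suc Y) A-ss′ A-s′s _ with () ← trans (sym A-s′s) (A-zero-sym s s′ A-ss′)
    finite-types (suc X) 0 A-ss′ A-s′s _ with () ← trans (sym A-ss′) (A-zero-sym s′ s A-s′s)
    finite-types 1 (suc (suc (suc (suc Y)))) _ _ 4≰XY = ⊥-elim (4≰XY (s≤s (s≤s (s≤s (s≤s z≤n)))))
    finite-types 2 (suc (suc Y)) _ _ 4≰XY =
      ⊥-elim (4≰XY (ℕP.*-mono-≤ {2} {2} {2} {suc (suc Y)} ℕP.≤-refl (s≤s (s≤s z≤n))))
    finite-types 3 (suc (suc Y)) _ _ 4≰XY =
      ⊥-elim (4≰XY (ℕP.*-mono-≤ {2} {3} {2} {suc (suc Y)} (s≤s (s≤s z≤n)) (s≤s (s≤s z≤n))))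
    finite-types (suc (suc (suc (suc X)))) (suc Y) _ _ 4≰XY =
      ⊥-elim (4≰XY (ℕP.*-mono-≤ {4} {suc (suc (suc (suc X)))} {1} {suc Y}
        (s≤s (s≤s (s≤s (s≤s z≤n)))) (s≤s z≤n)))

    alternating-positivity : ∀ m → RightAscent (alternating false m) →
      NonNegOnPair (act A (alternating false m) (e s))
    alternating-positivity m
      with nonpositive (A s s′) (proj₁ (proj₂ gcm) s s′ s≢s′)
         | nonpositive (A s′ s) (proj₁ (proj₂ gcm) s′ s (s≢s′ ∘ sym))
    ... | X , A-ss′ | Y , A-s′s with 4 ℕ.≤? X ℕ.* Y
    ... | yes 4≤XY = λ _ → Coordinates.alternating-root X Y A-ss′ A-s′s m (Rank2.run-nonneg-infinite X Y 4≤XY m)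
    ... | no  4≰XY = finite-types X Y A-ss′ A-s′s 4≰XY m

    dihedral-positivity : ∀ p → All InPair p → Reduced p → RightAscent p → NonNegOnPair (act A p (e s))
    dihedral-positivity p p-pair p-red ascent with reduced-alternating p p-pair p-red
    ... | inj₁ refl = 1ℤ , 0ℤ , ℤ.+≤+ z≤n , ℤ.+≤+ z≤n , λ k → unit (e s k) (e s′ k)
      where
      unit : ∀ x y → x ≡ 1ℤ * x + 0ℤ * y
      unit = solve-∀
    ... | inj₂ (true , m , refl) = ⊥-elim (ℕP.<⇒≱ longer
      (ascent (alternating false m) (alternating-InPair false m) (≈-sym (∷ʳ-involutive (alternating false m) s))))
      where
      longer : length (alternating false m) ℕ.< length (alternating false m ++ s ∷ [])
      longer = subst (length (alternating false m) ℕ.<_) (sym (length-∷ʳ (alternating false m) s)) (ℕP.n<1+n _)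
    ... | inj₂ (false , m , refl) = alternating-positivity (suc m) ascent

-- Positivity of roots

Negative : ∀ {n} → Vecℤ n → Set
Negative β = ∀ k → β k ℤ.≤ 0ℤ

*-nonneg : ∀ {a b} → 0ℤ ℤ.≤ a → 0ℤ ℤ.≤ b → 0ℤ ℤ.≤ a * b
*-nonneg {+ a} {+ b} _ _ = subst (0ℤ ℤ.≤_) (ℤP.pos-* a b) (ℤ.+≤+ z≤n)

module Positivity {n : ℕ} (A : Matrix n) (gcm : IsGCM A) (ℓ : Word n → ℕ) (isLength : IsLength A ℓ) where
  open WeylGroup A (proj₁ gcm)
  open Length A (proj₁ gcm) ℓ isLength

  RootPositivity : Word n → Set
  RootPositivity w = ∀ s → ℓ w ℕ.≤ ℓ (w ++ s ∷ []) → Positive A (act A w (e s))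

  module InductionStep (w : Word n) (IH : ∀ v → ℓ v ℕ.< ℓ w → RootPositivity v)
                       (s : Fin n) (ascent : ℓ w ℕ.≤ ℓ (w ++ s ∷ [])) where

    module _ (s′ : Fin n) (s≢s′ : s ≢ s′) where
      open Dihedral A (proj₁ gcm) s s′

      record Factorisation (v p : Word n) : Set where
        field
          product  : v ++ p ≈ w
          in-pair  : All InPair p
          additive : ℓ v ℕ.+ length p ≡ ℓ w
          nonempty : 1 ℕ.≤ length p
      open Factorisation

      AscentFactorisation : Set
      AscentFactorisation = Σ (Word n) λ v → Σ (Word n) λ p → Factorisation v p ×
        ℓ v ℕ.≤ ℓ (v ++ s ∷ []) × ℓ v ℕ.≤ ℓ (v ++ s′ ∷ [])

      shift : ∀ {v p} i → InPair i → Factorisation v p → ℓ (v ++ i ∷ []) ℕ.< ℓ v →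
        Factorisation (v ++ i ∷ []) (i ∷ p)
      shift {v} {p} i i-pair f descent = record
        { product  = ≈-trans (≡⇒≈ (LP.++-assoc v (i ∷ []) (i ∷ p)))
                       (≈-trans (++-congˡ v (∷-involutive i p)) (product f))
        ; in-pair  = i-pair ∷ in-pair f
        ; additive = trans (ℕP.+-suc (ℓ (v ++ i ∷ [])) (length p))
                       (trans (cong (ℕ._+ length p) (ℕP.≤-antisym descent (ℓ-∷ʳ-≥ v i))) (additive f))
        ; nonempty = s≤s z≤n }

      descend : ∀ fuel {v p} → ℓ v ℕ.< fuel → Factorisation v p → AscentFactorisation
      descend (suc fuel) {v} {p} ℓv<fuel f with ℓ (v ++ s ∷ []) ℕ.<? ℓ v | ℓ (v ++ s′ ∷ []) ℕ.<? ℓ v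
      ... | yes descent | _ =
        descend fuel (ℕP.<-≤-trans descent (ℕP.≤-pred ℓv<fuel)) (shift s (inj₁ refl) f descent)
      ... | no _ | yes descent′ =
        descend fuel (ℕP.<-≤-trans descent′ (ℕP.≤-pred ℓv<fuel)) (shift s′ (inj₂ refl) f descent′)
      ... | no ¬descent | no ¬descent′ = v , p , f , ℕP.≮⇒≥ ¬descent , ℕP.≮⇒≥ ¬descent′

      p-reduced : ∀ {v p} → Factorisation v p → Reduced p
      p-reduced {v} {p} f q q≈p = ℕP.+-cancelˡ-≤ (ℓ v) _ _ (begin
        ℓ v ℕ.+ length p  ≡⟨ additive f ⟩
        ℓ w               ≡⟨ ℓ-cong (product f) ⟨
        ℓ (v ++ p)        ≤⟨ ℓ-++ v p ⟩
        ℓ v ℕ.+ ℓ p       ≤⟨ ℕP.+-monoʳ-≤ (ℓ v) (ℓ-minimal q q≈p) ⟩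
        ℓ v ℕ.+ length q  ∎)
        where open ℕP.≤-Reasoning

      p-ascent : ∀ {v p} → Factorisation v p → RightAscent p
      p-ascent {v} {p} f q _ q≈ps = ℕP.+-cancelˡ-≤ (ℓ v) _ _ (begin
        ℓ v ℕ.+ length p    ≡⟨ additive f ⟩
        ℓ w                 ≤⟨ ascent ⟩
        ℓ (w ++ s ∷ [])     ≡⟨ ℓ-cong vq≈ws ⟨
        ℓ (v ++ q)          ≤⟨ ℓ-++ v q ⟩
        ℓ v ℕ.+ ℓ q         ≤⟨ ℕP.+-monoʳ-≤ (ℓ v) (ℓ≤length q) ⟩
        ℓ v ℕ.+ length q    ∎)
        where
        open ℕP.≤-Reasoning
        vq≈ws : v ++ q ≈ w ++ s ∷ []
        vq≈ws = ≈-trans (++-congˡ v q≈ps)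
          (≈-trans (≡⇒≈ (sym (LP.++-assoc v p (s ∷ [])))) (++-congʳ (s ∷ []) (product f)))

      from-ascent-factorisation : AscentFactorisation → Positive A (act A w (e s))
      from-ascent-factorisation (v , p , f , ascent-s , ascent-s′) k
        with dihedral-positivity gcm s≢s′ p (in-pair f) (p-reduced f) (p-ascent f)
      ... | c , d , c≥0 , d≥0 , p-root = subst (0ℤ ℤ.≤_) (sym combination)
        (ℤP.+-mono-≤ (*-nonneg c≥0 (IH-v s ascent-s k)) (*-nonneg d≥0 (IH-v s′ ascent-s′ k)))
        where
        IH-v : RootPositivity v
        IH-v = IH v (subst (ℓ v ℕ.<_) (additive f)
          (subst (ℕ._≤ ℓ v ℕ.+ length p) (ℕP.+-comm (ℓ v) 1) (ℕP.+-monoʳ-≤ (ℓ v) (nonempty f))))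
        combination : act A w (e s) k ≡ c * act A v (e s) k + d * act A v (e s′) k
        combination = begin
          act A w (e s) k                   ≡⟨ act-≗ (product f) (e s) k ⟨
          act A (v ++ p) (e s) k            ≡⟨ cong (λ γ → γ k) (act-++ v p (e s)) ⟩
          act A v (act A p (e s)) k         ≡⟨ act-cong v p-root k ⟩
          act A v (λ k → c * e s k + d * e s′ k) k
                                            ≡⟨ linear-combination (act-linear v) c d (e s) (e s′) k ⟩
          c * act A v (e s) k + d * act A v (e s′) k ∎
          where open ≡-Reasoning

    positive : Positive A (act A w (e s))
    positive with reduced-word w
    ... | r , r≈w , |r| with reverseView r
    ...   | [] = λ k → subst (0ℤ ℤ.≤_) (act-≗ r≈w (e s) k) (e-nonneg s k)
    ...   | r′ ∶ _ ∶ʳ s′ with s Fin.≟ s′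
    ...     | yes refl = ⊥-elim (ℕP.<⇒≱ descent ascent)
      where
      descent : ℓ (w ++ s ∷ []) ℕ.< ℓ w
      descent = begin-strict
        ℓ (w ++ s ∷ [])  ≡⟨ ℓ-cong (≈-trans (++-congʳ (s ∷ []) (≈-sym r≈w)) (∷ʳ-involutive r′ s)) ⟩
        ℓ r′             ≤⟨ ℓ≤length r′ ⟩
        length r′        <⟨ ℕP.n<1+n _ ⟩
        suc (length r′)  ≡⟨ length-∷ʳ r′ s ⟨
        length r         ≡⟨ |r| ⟩
        ℓ w              ∎
        where open ℕP.≤-Reasoning
    ...     | no s≢s′ = from-ascent-factorisation s′ s≢s′ (descend s′ s≢s′ (suc (ℓ r′)) (ℕP.n<1+n _) start)
      where
      start : Factorisation s′ s≢s′ r′ (s′ ∷ [])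
      start = record
        { product  = r≈w
        ; in-pair  = inj₂ refl ∷ []
        ; additive = ℕP.≤-antisym
            (begin
              ℓ r′ ℕ.+ 1          ≤⟨ ℕP.+-monoˡ-≤ 1 (ℓ≤length r′) ⟩
              length r′ ℕ.+ 1     ≡⟨ trans (ℕP.+-comm (length r′) 1) (sym (length-∷ʳ r′ s′)) ⟩
              length r            ≡⟨ |r| ⟩
              ℓ w                 ∎)
            (begin
              ℓ w                 ≡⟨ ℓ-cong r≈w ⟨
              ℓ (r′ ++ s′ ∷ [])   ≤⟨ ℓ-∷ʳ-≤ r′ s′ ⟩
              suc (ℓ r′)          ≡⟨ ℕP.+-comm 1 (ℓ r′) ⟩
              ℓ r′ ℕ.+ 1          ∎)
        ; nonempty = s≤s z≤n }
        where open ℕP.≤-Reasoning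

  positivity-below : ∀ fuel w → ℓ w ℕ.< fuel → RootPositivity w
  positivity-below (suc fuel) w ℓw<fuel = InductionStep.positive w
    (λ v ℓv<ℓw → positivity-below fuel v (ℕP.<-≤-trans ℓv<ℓw (ℕP.≤-pred ℓw<fuel)))

  positivity : ∀ w → RootPositivity w
  positivity w = positivity-below (suc (ℓ w)) w (ℕP.n<1+n (ℓ w))

module Roots {n : ℕ} (A : Matrix n) (gcm : IsGCM A) (ℓ : Word n → ℕ) (isLength : IsLength A ℓ) where
  open WeylGroup A (proj₁ gcm)
  open Length A (proj₁ gcm) ℓ isLength
  open Positivity A gcm ℓ isLength

  negate-negative : ∀ {β : Vecℤ n} → Negative β → Positive A (λ k → - β k)
  negate-negative β≤0 k = ℤP.neg-mono-≤ (β≤0 k)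

  negate-positive : ∀ {β : Vecℤ n} → Positive A (λ k → - β k) → Negative β
  negate-positive {β} -β≥0 k = subst (ℤ._≤ 0ℤ) (ℤP.neg-involutive (β k)) (ℤP.neg-mono-≤ (-β≥0 k))

  root-sign-unique : ∀ u j → Positive A (act A u (e j)) → Negative (act A u (e j)) → ⊥
  root-sign-unique u j β≥0 β≤0 with begin
      1ℤ                                          ≡⟨ e-diag j ⟨
      e j j                                       ≡⟨ act-reverse-inverseˡ u (e j) j ⟨
      act A (reverse u) (act A u (e j)) j         ≡⟨ act-cong (reverse u) (λ k → ℤP.≤-antisym (β≤0 k) (β≥0 k)) j ⟩
      act A (reverse u) (λ _ → 0ℤ) j              ≡⟨ linear-zero (act-linear (reverse u)) j ⟩
      0ℤ                                          ∎
    where open ≡-Reasoning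
  ... | ()

  act-∷ʳ-root : ∀ w s → act A (w ++ s ∷ []) (e s) ≗ (λ k → - act A w (e s) k)
  act-∷ʳ-root w s k = trans (cong (λ γ → γ k) (act-++ w (s ∷ []) (e s)))
    (trans (act-cong w (sRoot-root s) k) (linear-neg (act-linear w) (e s) k))

  descent⇒negative : ∀ w s → ℓ (w ++ s ∷ []) ℕ.≤ ℓ w → Negative (act A w (e s))
  descent⇒negative w s ℓws≤ℓw = negate-positive λ k → subst (0ℤ ℤ.≤_) (act-∷ʳ-root w s k)
    (positivity (w ++ s ∷ []) s (subst (ℓ (w ++ s ∷ []) ℕ.≤_) (sym (ℓ-cong (∷ʳ-involutive w s))) ℓws≤ℓw) k)

  ℓ-∷ʳ : ∀ w s → ℓ (w ++ s ∷ []) ≡ suc (ℓ w) ⊎ ℓ w ≡ suc (ℓ (w ++ s ∷ []))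
  ℓ-∷ʳ w s with ℕP.<-cmp (ℓ (w ++ s ∷ [])) (ℓ w)
  ... | tri< ℓws<ℓw _ _ = inj₂ (ℕP.≤-antisym (ℓ-∷ʳ-≥ w s) ℓws<ℓw)
  ... | tri≈ _ ℓws≡ℓw _ = ⊥-elim (root-sign-unique w s
          (positivity w s (ℕP.≤-reflexive (sym ℓws≡ℓw))) (descent⇒negative w s (ℕP.≤-reflexive ℓws≡ℓw)))
  ... | tri> _ _ ℓws>ℓw = inj₁ (ℕP.≤-antisym (ℓ-∷ʳ-≤ w s) ℓws>ℓw)

  negative⇒descent : ∀ w s → Negative (act A w (e s)) → ℓ w ≡ suc (ℓ (w ++ s ∷ []))
  negative⇒descent w s β≤0 with ℓ-∷ʳ w s
  ... | inj₂ down = down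
  ... | inj₁ up   = ⊥-elim (root-sign-unique w s (positivity w s (subst (ℓ w ℕ.≤_) (sym up) (ℕP.n≤1+n _))) β≤0)

  root-sign : ∀ w s → Positive A (act A w (e s)) ⊎ Negative (act A w (e s))
  root-sign w s with ℓ-∷ʳ w s
  ... | inj₁ up   = inj₁ (positivity w s (subst (ℓ w ℕ.≤_) (sym up) (ℕP.n≤1+n _)))
  ... | inj₂ down = inj₂ (descent⇒negative w s (subst (ℓ (w ++ s ∷ []) ℕ.≤_) (sym down) (ℕP.n≤1+n _)))

  positive⇒ascent : ∀ w s → Positive A (act A w (e s)) → ℓ (w ++ s ∷ []) ≡ suc (ℓ w)
  positive⇒ascent w s β≥0 with ℓ-∷ʳ w s
  ... | inj₁ up   = up
  ... | inj₂ down = ⊥-elim (root-sign-unique w s β≥0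
          (descent⇒negative w s (subst (ℓ (w ++ s ∷ []) ℕ.≤_) (sym down) (ℕP.n≤1+n _))))

  ℓ-∷-reverse : ∀ i w → ℓ (i ∷ w) ≡ ℓ (reverse w ++ i ∷ [])
  ℓ-∷-reverse i w = trans (sym (ℓ-reverse (i ∷ w))) (cong ℓ (LP.unfold-reverse i w))

  ℓ-∷ : ∀ i w → ℓ (i ∷ w) ≡ suc (ℓ w) ⊎ ℓ w ≡ suc (ℓ (i ∷ w))
  ℓ-∷ i w with ℓ-∷ʳ (reverse w) i
  ... | inj₁ up   = inj₁ (trans (ℓ-∷-reverse i w) (trans up (cong suc (ℓ-reverse w))))
  ... | inj₂ down = inj₂ (trans (sym (ℓ-reverse w)) (trans down (cong suc (sym (ℓ-∷-reverse i w)))))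

  left-ascent⇒positive : ∀ i w → ℓ (i ∷ w) ≡ suc (ℓ w) → Positive A (act A (reverse w) (e i))
  left-ascent⇒positive i w up = positivity (reverse w) i (begin
    ℓ (reverse w)             ≡⟨ ℓ-reverse w ⟩
    ℓ w                       ≤⟨ ℕP.n≤1+n _ ⟩
    suc (ℓ w)                 ≡⟨ up ⟨
    ℓ (i ∷ w)                 ≡⟨ ℓ-∷-reverse i w ⟩
    ℓ (reverse w ++ i ∷ [])   ∎)
    where open ℕP.≤-Reasoning

  left-descent⇒negative : ∀ i w → ℓ w ≡ suc (ℓ (i ∷ w)) → Negative (act A (reverse w) (e i))
  left-descent⇒negative i w down = descent⇒negative (reverse w) i (begin
    ℓ (reverse w ++ i ∷ [])   ≡⟨ ℓ-∷-reverse i w ⟨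
    ℓ (i ∷ w)                 ≤⟨ ℕP.n≤1+n _ ⟩
    suc (ℓ (i ∷ w))           ≡⟨ down ⟨
    ℓ w                       ≡⟨ ℓ-reverse w ⟨
    ℓ (reverse w)             ∎)
    where open ℕP.≤-Reasoning

  simple-root : ∀ u j i → Positive A (act A u (e j)) → Negative (sRoot A i (act A u (e j))) →
    act A u (e j) ≗ e i
  simple-root u j i β≥0 sβ≤0 = coordinates
    where
    β : Vecℤ n
    β = act A u (e j)
    off : ∀ {k} → i ≢ k → β k ≡ 0ℤ
    off {k} i≢k = ℤP.≤-antisym (subst (ℤ._≤ 0ℤ) unchanged (sβ≤0 k)) (β≥0 k)
      where
      minus-zero : ∀ x c → x - c * 0ℤ ≡ x
      minus-zero = solve-∀
      unchanged : sRoot A i β k ≡ β k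
      unchanged = trans (cong (λ z → β k - coroot-pairing i β * z) (e-off i≢k)) (minus-zero (β k) (coroot-pairing i β))
    β-multiple : β ≗ (λ k → β i * e i k)
    β-multiple k with i Fin.≟ k
    ... | yes refl = sym (ℤP.*-identityʳ (β i))
    ... | no i≢k   = trans (off i≢k) (sym (ℤP.*-zeroʳ (β i)))
    product-one : ∀ {a z} → 0ℤ ℤ.≤ a → a * z ≡ 1ℤ → a ≡ 1ℤ
    product-one {+ a} {z} _ az≡1 =
      cong +_ (ℕP.m*n≡1⇒m≡1 a ℤ.∣ z ∣ (trans (sym (ℤP.abs-* (+ a) z)) (cong ℤ.∣_∣ az≡1)))
    βi≡1 : β i ≡ 1ℤ
    βi≡1 = product-one (β≥0 i) (begin
      β i * act A (reverse u) (e i) j            ≡⟨ linear-scale (act-linear (reverse u)) (β i) (e i) j ⟨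
      act A (reverse u) (λ k → β i * e i k) j    ≡⟨ act-cong (reverse u) β-multiple j ⟨
      act A (reverse u) β j                      ≡⟨ act-reverse-inverseˡ u (e j) j ⟩
      e j j                                      ≡⟨ e-diag j ⟩
      1ℤ                                         ∎)
      where open ≡-Reasoning
    coordinates : β ≗ e i
    coordinates k with i Fin.≟ k
    ... | yes refl = βi≡1
    ... | no i≢k   = off i≢k

  reflectionWord : Word n → Fin n → Word n
  reflectionWord u j = u ++ j ∷ reverse u

  act-reflectionWord : ∀ u j γ → act A (reflectionWord u j) γ
    ≗ (λ k → γ k - coroot-pairing j (act A (reverse u) γ) * act A u (e j) k)
  act-reflectionWord u j γ k = begin
    act A (u ++ j ∷ reverse u) γ k
      ≡⟨ cong (λ δ → δ k) (act-++ u (j ∷ reverse u) γ) ⟩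
    act A u (sRoot A j y) k
      ≡⟨ act-cong u (λ l → as-combination (y l) c (e j l)) k ⟩
    act A u (λ l → 1ℤ * y l + (- c) * e j l) k
      ≡⟨ linear-combination (act-linear u) 1ℤ (- c) y (e j) k ⟩
    1ℤ * act A u y k + (- c) * act A u (e j) k
      ≡⟨ cong (λ z → 1ℤ * z + (- c) * act A u (e j) k) (act-reverse-inverseʳ u γ k) ⟩
    1ℤ * γ k + (- c) * act A u (e j) k
      ≡⟨ as-combination (γ k) c (act A u (e j) k) ⟨
    γ k - c * act A u (e j) k
      ∎
    where
    open ≡-Reasoning
    y : Vecℤ n
    y = act A (reverse u) γ
    c : ℤ
    c = coroot-pairing j y
    as-combination : ∀ y c x → y - c * x ≡ 1ℤ * y + (- c) * x
    as-combination = solve-∀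

  positive-coordinate : ∀ w k → act A w (e k) k ≡ 1ℤ → Positive A (act A w (e k))
  positive-coordinate w k one with root-sign w k
  ... | inj₁ β≥0 = β≥0
  ... | inj₂ β≤0 with subst (ℤ._≤ 0ℤ) one (β≤0 k)
  ...   | ℤ.+≤+ ()

  -- The coefficients c k of α_i in t(α_k) are forced to be A i k because s_i t and t s_i
  -- send α_k to the roots α_k ± (c k - A i k) α_i, which must both be positive.
  reflectionWord-simple : ∀ u j i → act A u (e j) ≗ e i → reflectionWord u j ≈ i ∷ []
  reflectionWord-simple u j i uαj≗αi = ≈W⇒≈ λ k l →
    trans (t-basis k l) (cong (λ z → e k l - z * e i l) (trans (c≡A k) (sym (ΣI-selectʳ n k (A i)))))
    where
    t : Word n
    t = reflectionWord u j
    c : Fin n → ℤ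
    c k = coroot-pairing j (act A (reverse u) (e k))

    t-basis : ∀ k → act A t (e k) ≗ (λ l → e k l - c k * e i l)
    t-basis k l = trans (act-reflectionWord u j (e k) l) (cong (λ z → e k l - c k * z) (uαj≗αi l))

    c-root : c i ≡ + 2
    c-root = begin
      coroot-pairing j (act A (reverse u) (e i))  ≡⟨ ΣI-cong n (λ m → cong (A j m *_) (u⁻¹αi≗αj m)) ⟩
      coroot-pairing j (e j)                      ≡⟨ ΣI-selectʳ n j (A j) ⟩
      A j j                                       ≡⟨ proj₁ gcm j ⟩
      + 2                                         ∎
      where
      open ≡-Reasoning
      u⁻¹αi≗αj : act A (reverse u) (e i) ≗ e j
      u⁻¹αi≗αj m = trans (act-cong (reverse u) (λ l → sym (uαj≗αi l)) m) (act-reverse-inverseˡ u (e j) m)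

    pairing-shift : ∀ k → coroot-pairing i (λ l → e k l - c k * e i l) ≡ A i k - c k * + 2
    pairing-shift k = begin
      ΣI n (λ m → A i m * (e k m - c k * e i m))
        ≡⟨ ΣI-cong n (λ m → distribute (A i m) (e k m) (c k) (e i m)) ⟩
      ΣI n (λ m → A i m * e k m - c k * (A i m * e i m))
        ≡⟨ ΣI-distrib-- (λ m → A i m * e k m) (λ m → c k * (A i m * e i m)) ⟩
      coroot-pairing i (e k) - ΣI n (λ m → c k * (A i m * e i m))
        ≡⟨ cong₂ _-_ (ΣI-selectʳ n k (A i)) (sym (*-distribˡ-ΣI (c k) (λ m → A i m * e i m))) ⟩
      A i k - c k * coroot-pairing i (e i)
        ≡⟨ cong (λ z → A i k - c k * z) (trans (ΣI-selectʳ n i (A i)) (proj₁ gcm i)) ⟩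
      A i k - c k * + 2
        ∎
      where
      open ≡-Reasoning
      distribute : ∀ a x c y → a * (x - c * y) ≡ a * x - c * (a * y)
      distribute = solve-∀

    s-t : ∀ k → act A (i ∷ t) (e k) ≗ (λ l → e k l + (c k - A i k) * e i l)
    s-t k l = begin
      sRoot A i (act A t (e k)) l
        ≡⟨ linear-cong (sRoot-linear i) (t-basis k) l ⟩
      (e k l - c k * e i l) - coroot-pairing i (λ l → e k l - c k * e i l) * e i l
        ≡⟨ cong (λ z → (e k l - c k * e i l) - z * e i l) (pairing-shift k) ⟩
      (e k l - c k * e i l) - (A i k - c k * + 2) * e i l
        ≡⟨ collect (e k l) (e i l) (c k) (A i k) ⟩
      e k l + (c k - A i k) * e i l
        ∎
      where
      open ≡-Reasoning
      collect : ∀ x y c a → (x - c * y) - (a - c * + 2) * y ≡ x + (c - a) * y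
      collect = solve-∀

    t-s : ∀ k → act A (t ++ i ∷ []) (e k) ≗ (λ l → e k l + (A i k - c k) * e i l)
    t-s k l = begin
      act A (t ++ i ∷ []) (e k) l
        ≡⟨ cong (λ δ → δ l) (act-++ t (i ∷ []) (e k)) ⟩
      act A t (sRoot A i (e k)) l
        ≡⟨ act-cong t (λ m → cong (λ z → e k m - z * e i m) (ΣI-selectʳ n k (A i))) l ⟩
      act A t (λ m → e k m - A i k * e i m) l
        ≡⟨ act-cong t (λ m → as-combination (e k m) (A i k) (e i m)) l ⟩
      act A t (λ m → 1ℤ * e k m + (- A i k) * e i m) l
        ≡⟨ linear-combination (act-linear t) 1ℤ (- A i k) (e k) (e i) l ⟩
      1ℤ * act A t (e k) l + (- A i k) * act A t (e i) l
        ≡⟨ cong₂ (λ x y → 1ℤ * x + (- A i k) * y) (t-basis k l) (t-basis i l) ⟩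
      1ℤ * (e k l - c k * e i l) + (- A i k) * (e i l - c i * e i l)
        ≡⟨ cong (λ z → 1ℤ * (e k l - c k * e i l) + (- A i k) * (e i l - z * e i l)) c-root ⟩
      1ℤ * (e k l - c k * e i l) + (- A i k) * (e i l - + 2 * e i l)
        ≡⟨ collect (e k l) (e i l) (c k) (A i k) ⟩
      e k l + (A i k - c k) * e i l
        ∎
      where
      open ≡-Reasoning
      as-combination : ∀ x a y → x - a * y ≡ 1ℤ * x + (- a) * y
      as-combination = solve-∀
      collect : ∀ x y c a → 1ℤ * (x - c * y) + (- a) * (y - + 2 * y) ≡ x + (a - c) * y
      collect = solve-∀

    shift-nonneg : ∀ w k d → i ≢ k → act A w (e k) ≗ (λ l → e k l + d * e i l) → 0ℤ ℤ.≤ d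
    shift-nonneg w k d i≢k wαk≗ = subst (0ℤ ℤ.≤_) (trans (wαk≗ i) at-i) (positive-coordinate w k at-k i)
      where
      at-k : act A w (e k) k ≡ 1ℤ
      at-k = trans (wαk≗ k) (trans (cong₂ (λ x y → x + d * y) (e-diag k) (e-off i≢k)) (one-plus-zero d))
        where
        one-plus-zero : ∀ d → 1ℤ + d * 0ℤ ≡ 1ℤ
        one-plus-zero = solve-∀
      at-i : e k i + d * e i i ≡ d
      at-i = trans (cong₂ (λ x y → x + d * y) (e-off (i≢k ∘ sym)) (e-diag i)) (zero-plus-one d)
        where
        zero-plus-one : ∀ d → 0ℤ + d * 1ℤ ≡ d
        zero-plus-one = solve-∀

    c≡A : ∀ k → c k ≡ A i k
    c≡A k with i Fin.≟ k
    ... | yes refl = trans c-root (sym (proj₁ gcm i))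
    ... | no i≢k   = ℤP.≤-antisym
      (ℤP.0≤i-j⇒j≤i (shift-nonneg (t ++ i ∷ []) k (A i k - c k) i≢k (t-s k)))
      (ℤP.0≤i-j⇒j≤i (shift-nonneg (i ∷ t) k (c k - A i k) i≢k (s-t k)))

  reflectionWord-involutive : ∀ u j → reflectionWord u j ++ reflectionWord u j ≈ []
  reflectionWord-involutive u j = begin
    (u ++ j ∷ reverse u) ++ u ++ j ∷ reverse u   ≡⟨ LP.++-assoc u (j ∷ reverse u) _ ⟩
    u ++ j ∷ reverse u ++ u ++ j ∷ reverse u     ≈⟨ ++-congˡ u (∷-cong j (reverse-++-cancel u (j ∷ reverse u))) ⟩
    u ++ j ∷ j ∷ reverse u                       ≈⟨ ++-congˡ u (∷-involutive j (reverse u)) ⟩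
    u ++ reverse u                               ≈⟨ ++-reverseʳ u ⟩
    []                                           ∎
    where open SetoidReasoning ≈-setoid

  ++-reflectionWord-involutive : ∀ w u j → (w ++ reflectionWord u j) ++ reflectionWord u j ≈ w
  ++-reflectionWord-involutive w u j = begin
    (w ++ t) ++ t   ≡⟨ LP.++-assoc w t t ⟩
    w ++ t ++ t     ≈⟨ ++-congˡ w (reflectionWord-involutive u j) ⟩
    w ++ []         ≡⟨ LP.++-identityʳ w ⟩
    w               ∎
    where
    open SetoidReasoning ≈-setoid
    t : Word n
    t = reflectionWord u j

  reflectionWord-++ : ∀ v u j → reflectionWord (v ++ u) j ≡ v ++ reflectionWord u j ++ reverse v
  reflectionWord-++ v u j = begin
    (v ++ u) ++ j ∷ reverse (v ++ u)         ≡⟨ LP.++-assoc v u _ ⟩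
    v ++ u ++ j ∷ reverse (v ++ u)           ≡⟨ cong (λ r → v ++ u ++ j ∷ r) (LP.reverse-++ v u) ⟩
    v ++ u ++ j ∷ reverse u ++ reverse v     ≡⟨ cong (v ++_) (LP.++-assoc u (j ∷ reverse u) (reverse v)) ⟨
    v ++ (u ++ j ∷ reverse u) ++ reverse v   ∎
    where open ≡-Reasoning

  ++-reflectionWord-reverse : ∀ v i → v ++ reflectionWord (reverse v) i ≈ i ∷ v
  ++-reflectionWord-reverse v i = begin
    v ++ reverse v ++ i ∷ reverse (reverse v)   ≡⟨ LP.++-assoc v (reverse v) _ ⟨
    (v ++ reverse v) ++ i ∷ reverse (reverse v) ≈⟨ ++-congʳ (i ∷ reverse (reverse v)) (++-reverseʳ v) ⟩
    i ∷ reverse (reverse v)                     ≡⟨ cong (i ∷_) (LP.reverse-involutive v) ⟩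
    i ∷ v                                       ∎
    where open SetoidReasoning ≈-setoid

  act-reflectionWord-root : ∀ u j → act A (reflectionWord u j) (act A u (e j)) ≗ (λ k → - act A u (e j) k)
  act-reflectionWord-root u j k = begin
    act A (reflectionWord u j) β k                              ≡⟨ act-reflectionWord u j β k ⟩
    β k - coroot-pairing j (act A (reverse u) β) * β k          ≡⟨ cong (λ z → β k - z * β k) pairing ⟩
    β k - + 2 * β k                                             ≡⟨ flip (β k) ⟩
    - β k                                                       ∎
    where
    open ≡-Reasoning
    β : Vecℤ n
    β = act A u (e j)
    pairing : coroot-pairing j (act A (reverse u) β) ≡ + 2
    pairing = trans (ΣI-cong n (λ m → cong (A j m *_) (act-reverse-inverseˡ u (e j) m)))
      (trans (ΣI-selectʳ n j (A j)) (proj₁ gcm j))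
    flip : ∀ x → x - + 2 * x ≡ - x
    flip = solve-∀

  sign-change : ∀ w u j → Positive A (act A u (e j)) → Negative (act A w (act A u (e j))) →
    Σ (Word n) λ w₁ → Σ (Fin n) λ x → Σ (Word n) λ w₂ →
      (w ≡ w₁ ++ x ∷ w₂) × (act A w₂ (act A u (e j)) ≗ e x)
  sign-change []      u j β≥0 β≤0 = ⊥-elim (root-sign-unique u j β≥0 β≤0)
  sign-change (x ∷ w) u j β≥0 xwβ≤0 with root-sign (w ++ u) j
  ... | inj₁ wβ≥0 = [] , x , w , refl , λ k →
    trans (cong (λ γ → γ k) (sym (act-++ w u (e j))))
      (simple-root (w ++ u) j x wβ≥0 (λ k → subst (ℤ._≤ 0ℤ) (cong (λ γ → sRoot A x γ k) (sym (act-++ w u (e j)))) (xwβ≤0 k)) k)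
  ... | inj₂ wβ≤0 with sign-change w u j β≥0 (λ k → subst (ℤ._≤ 0ℤ) (cong (λ γ → γ k) (act-++ w u (e j))) (wβ≤0 k))
  ...   | w₁ , y , w₂ , refl , w₂β≗αy = x ∷ w₁ , y , w₂ , refl , w₂β≗αy

  exchange : ∀ w u j → Positive A (act A u (e j)) → Negative (act A w (act A u (e j))) →
    Σ (Word n) λ w₁ → Σ (Fin n) λ x → Σ (Word n) λ w₂ →
      (w ≡ w₁ ++ x ∷ w₂) × (w ++ reflectionWord u j ≈ w₁ ++ w₂)
  exchange w u j β≥0 wβ≤0 with sign-change w u j β≥0 wβ≤0
  ... | w₁ , x , w₂ , refl , w₂β≗αx = w₁ , x , w₂ , refl ,
    ≈-trans (≡⇒≈ (LP.++-assoc w₁ (x ∷ w₂) t)) (++-congˡ w₁ deleted)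
    where
    open SetoidReasoning ≈-setoid
    t : Word n
    t = reflectionWord u j
    deleted : x ∷ w₂ ++ t ≈ w₂
    deleted = begin
      x ∷ w₂ ++ t                                  ≈⟨ ++-congʳ (w₂ ++ t) (reflectionWord-simple (w₂ ++ u) j x
                                                        (λ k → trans (cong (λ γ → γ k) (act-++ w₂ u (e j))) (w₂β≗αx k))) ⟨
      reflectionWord (w₂ ++ u) j ++ w₂ ++ t        ≡⟨ cong (_++ w₂ ++ t) (reflectionWord-++ w₂ u j) ⟩
      (w₂ ++ t ++ reverse w₂) ++ w₂ ++ t           ≡⟨ LP.++-assoc w₂ (t ++ reverse w₂) (w₂ ++ t) ⟩
      w₂ ++ (t ++ reverse w₂) ++ w₂ ++ t           ≡⟨ cong (w₂ ++_) (LP.++-assoc t (reverse w₂) (w₂ ++ t)) ⟩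
      w₂ ++ t ++ reverse w₂ ++ w₂ ++ t             ≈⟨ ++-congˡ w₂ (++-congˡ t (reverse-++-cancel w₂ t)) ⟩
      w₂ ++ t ++ t                                 ≡⟨ LP.++-assoc w₂ t t ⟨
      (w₂ ++ t) ++ t                               ≈⟨ ++-reflectionWord-involutive w₂ u j ⟩
      w₂                                           ∎

  length-delete : ∀ (w₁ : Word n) x w₂ → length (w₁ ++ x ∷ w₂) ≡ suc (length (w₁ ++ w₂))
  length-delete w₁ x w₂ = trans (LP.length-++ w₁)
    (trans (ℕP.+-suc (length w₁) (length w₂)) (cong suc (sym (LP.length-++ w₁))))

  negative⇒shorter : ∀ w u j → Positive A (act A u (e j)) → Negative (act A w (act A u (e j))) →
    ℓ (w ++ reflectionWord u j) ℕ.< ℓ w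
  negative⇒shorter w u j β≥0 wβ≤0 with reduced-word w
  ... | r , r≈w , |r| with exchange r u j β≥0 (λ k → subst (ℤ._≤ 0ℤ) (sym (act-≗ r≈w _ k)) (wβ≤0 k))
  ...   | w₁ , x , w₂ , refl , rt≈ = begin-strict
    ℓ (w ++ t)              ≡⟨ ℓ-cong (≈-trans (++-congʳ t (≈-sym r≈w)) rt≈) ⟩
    ℓ (w₁ ++ w₂)            ≤⟨ ℓ≤length (w₁ ++ w₂) ⟩
    length (w₁ ++ w₂)       <⟨ ℕP.n<1+n _ ⟩
    suc (length (w₁ ++ w₂)) ≡⟨ length-delete w₁ x w₂ ⟨
    length r                ≡⟨ |r| ⟩
    ℓ w                     ∎
    where
    open ℕP.≤-Reasoning
    t : Word n
    t = reflectionWord u j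

  positive⇒longer : ∀ w u j → Positive A (act A u (e j)) → Positive A (act A w (act A u (e j))) →
    ℓ w ℕ.< ℓ (w ++ reflectionWord u j)
  positive⇒longer w u j β≥0 wβ≥0 = subst (ℕ._< ℓ (w ++ t)) (ℓ-cong (++-reflectionWord-involutive w u j))
    (negative⇒shorter (w ++ t) u j β≥0 λ k → subst (ℤ._≤ 0ℤ) (sym (flipped k)) (ℤP.neg-mono-≤ (wβ≥0 k)))
    where
    t : Word n
    t = reflectionWord u j
    flipped : act A (w ++ t) (act A u (e j)) ≗ (λ k → - act A w (act A u (e j)) k)
    flipped k = trans (cong (λ γ → γ k) (act-++ w t _))
      (trans (act-cong w (act-reflectionWord-root u j) k) (linear-neg (act-linear w) _ k))

  Cover : Word n → Word n → Word n → Fin n → Set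
  Cover v w u j = (w ≈ v ++ reflectionWord u j) × Positive A (act A u (e j)) × (ℓ w ≡ suc (ℓ v))

  Deletion : Word n → Word n → Set
  Deletion W v = Σ (Word n) λ w₁ → Σ (Fin n) λ x → Σ (Word n) λ w₂ → (W ≡ w₁ ++ x ∷ w₂) × (v ≈ w₁ ++ w₂)

  cover-deletion : ∀ W v u j → Positive A (act A u (e j)) → v ≈ W ++ reflectionWord u j → ℓ v ℕ.< ℓ W →
    Deletion W v
  cover-deletion W v u j β≥0 v≈Wt ℓv<ℓW with root-sign (W ++ u) j
  ... | inj₁ Wβ≥0 = ⊥-elim (ℕP.<-asym ℓv<ℓW (subst (ℓ W ℕ.<_) (ℓ-cong (≈-sym v≈Wt))
          (positive⇒longer W u j β≥0 λ k → subst (0ℤ ℤ.≤_) (cong (λ γ → γ k) (act-++ W u (e j))) (Wβ≥0 k))))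
  ... | inj₂ Wβ≤0 with exchange W u j β≥0 (λ k → subst (ℤ._≤ 0ℤ) (cong (λ γ → γ k) (act-++ W u (e j))) (Wβ≤0 k))
  ...   | w₁ , x , w₂ , W≡ , Wt≈ = w₁ , x , w₂ , W≡ , ≈-trans v≈Wt Wt≈

  private
    cover-shift : ∀ {v w} r u j → r ≈ w → Cover v w u j → v ≈ r ++ reflectionWord u j
    cover-shift {v} {w} r u j r≈w (w≈vt , _ , _) = ≈-trans (≈-sym (++-reflectionWord-involutive v u j))
      (++-congʳ (reflectionWord u j) (≈-trans (≈-sym w≈vt) (≈-sym r≈w)))

  lifting : ∀ {v x} i u j → Cover v (i ∷ x) u j → ℓ (i ∷ x) ≡ suc (ℓ x) → ℓ (i ∷ v) ≡ suc (ℓ v) → v ≈ x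
  lifting {v} {x} i u j cover@(_ , β≥0 , ℓix≡) ascent-x ascent-v = from-reduced (reduced-word x)
    where
    ℓx≡ℓv : ℓ x ≡ ℓ v
    ℓx≡ℓv = ℕP.suc-injective (trans (sym ascent-x) ℓix≡)

    from-deletion : ∀ r → r ≈ x → length r ≡ ℓ x → Deletion (i ∷ r) v → v ≈ x
    from-deletion r r≈x |r| ([] , _ , _ , refl , v≈r) = ≈-trans v≈r r≈x
    from-deletion r r≈x |r| ((_ ∷ w₁) , x′ , w₂ , refl , v≈) = ⊥-elim (ℕP.<⇒≱ shorter (ℓ-minimal (w₁ ++ w₂) iv≈))
      where
      iv≈ : w₁ ++ w₂ ≈ i ∷ v
      iv≈ = ≈-sym (≈-trans (∷-cong i v≈) (∷-involutive i (w₁ ++ w₂)))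
      shorter : length (w₁ ++ w₂) ℕ.< ℓ (i ∷ v)
      shorter = begin-strict
        length (w₁ ++ w₂)         <⟨ ℕP.n<1+n _ ⟩
        suc (length (w₁ ++ w₂))   ≡⟨ length-delete w₁ x′ w₂ ⟨
        length (w₁ ++ x′ ∷ w₂)    ≡⟨ |r| ⟩
        ℓ x                       ≡⟨ ℓx≡ℓv ⟩
        ℓ v                       <⟨ ℕP.n<1+n _ ⟩
        suc (ℓ v)                 ≡⟨ ascent-v ⟨
        ℓ (i ∷ v)                 ∎
        where open ℕP.≤-Reasoning

    from-reduced : (Σ (Word n) λ r → (r ≈ x) × (length r ≡ ℓ x)) → v ≈ x
    from-reduced (r , r≈x , |r|) = from-deletion r r≈x |r|
      (cover-deletion (i ∷ r) v u j β≥0 (cover-shift (i ∷ r) u j (∷-cong i r≈x) cover)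
        (subst (ℓ v ℕ.<_) (trans (sym ℓix≡) (ℓ-cong (∷-cong i (≈-sym r≈x)))) (ℕP.n<1+n _)))

  lifting-parabolic : ∀ J {v x} i j u j′ → InWJ A ℓ J v → j ∈ J → i ∷ x ≈ x ++ j ∷ [] →
    Cover v (i ∷ x) u j′ → ℓ (i ∷ x) ≡ suc (ℓ x) → v ≈ x
  lifting-parabolic J {v} {x} i j u j′ v-minimal j∈J ix≈xj cover@(_ , β≥0 , ℓix≡) ascent-x =
    from-reduced (reduced-word x)
    where
    ℓx≡ℓv : ℓ x ≡ ℓ v
    ℓx≡ℓv = ℕP.suc-injective (trans (sym ascent-x) ℓix≡)

    from-split : ∀ r → r ≈ x → length r ≡ ℓ x → ∀ w₁ z w₂ → v ≈ w₁ ++ w₂ →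
      (w₂ ≡ [] × w₁ ≡ r) ⊎ Σ (Word n) (λ w₂′ → (w₂ ≡ w₂′ ++ j ∷ []) × (r ≡ w₁ ++ z ∷ w₂′)) → v ≈ x
    from-split r r≈x |r| w₁ z w₂ v≈ (inj₁ (refl , refl)) = ≈-trans v≈ (≈-trans (≡⇒≈ (LP.++-identityʳ r)) r≈x)
    from-split r r≈x |r| w₁ z w₂ v≈ (inj₂ (w₂′ , refl , refl)) =
      ⊥-elim (ℕP.<⇒≱ shorter (ℕP.≤-trans (v-minimal (j ∷ []) (j∈J ∷ [])) (ℓ-minimal (w₁ ++ w₂′) vj≈)))
      where
      vj≈ : w₁ ++ w₂′ ≈ v ++ j ∷ []
      vj≈ = ≈-sym (begin
        v ++ j ∷ []                        ≈⟨ ++-congʳ (j ∷ []) v≈ ⟩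
        (w₁ ++ w₂′ ++ j ∷ []) ++ j ∷ []    ≡⟨ cong (_++ j ∷ []) (LP.++-assoc w₁ w₂′ (j ∷ [])) ⟨
        ((w₁ ++ w₂′) ++ j ∷ []) ++ j ∷ []  ≈⟨ ∷ʳ-involutive (w₁ ++ w₂′) j ⟩
        w₁ ++ w₂′                          ∎)
        where open SetoidReasoning ≈-setoid
      shorter : length (w₁ ++ w₂′) ℕ.< ℓ v
      shorter = begin-strict
        length (w₁ ++ w₂′)         <⟨ ℕP.n<1+n _ ⟩
        suc (length (w₁ ++ w₂′))   ≡⟨ length-delete w₁ z w₂′ ⟨
        length (w₁ ++ z ∷ w₂′)     ≡⟨ |r| ⟩
        ℓ x                        ≡⟨ ℓx≡ℓv ⟩
        ℓ v                        ∎
        where open ℕP.≤-Reasoning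

    from-deletion : ∀ r → r ≈ x → length r ≡ ℓ x → Deletion (r ++ j ∷ []) v → v ≈ x
    from-deletion r r≈x |r| (w₁ , z , w₂ , rj≡ , v≈) =
      from-split r r≈x |r| w₁ z w₂ v≈ (∷ʳ-split r j w₁ z w₂ rj≡)

    from-reduced : (Σ (Word n) λ r → (r ≈ x) × (length r ≡ ℓ x)) → v ≈ x
    from-reduced (r , r≈x , |r|) = from-deletion r r≈x |r|
      (cover-deletion (r ++ j ∷ []) v u j′ β≥0 (cover-shift (r ++ j ∷ []) u j′ rj≈ix cover)
        (subst (ℓ v ℕ.<_) (trans (sym ℓix≡) (ℓ-cong (≈-sym rj≈ix))) (ℕP.n<1+n _)))
      where
      rj≈ix : r ++ j ∷ [] ≈ i ∷ x
      rj≈ix = ≈-trans (++-congʳ (j ∷ []) r≈x) (≈-sym ix≈xj)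

-- Minimal coset representatives

module Parabolic {n : ℕ} (A : Matrix n) (gcm : IsGCM A) (ℓ : Word n → ℕ) (isLength : IsLength A ℓ)
                 (J : Subset n) where
  open WeylGroup A (proj₁ gcm)
  open Length A (proj₁ gcm) ℓ isLength
  open Positivity A gcm ℓ isLength
  open Roots A gcm ℓ isLength

  SupportedOnJ : Vecℤ n → Set
  SupportedOnJ β = ∀ k → k ∉ J → β k ≡ 0ℤ

  e-supported : ∀ {l} → l ∈ J → SupportedOnJ (e l)
  e-supported l∈J k k∉J = e-off λ l≡k → k∉J (subst (_∈ J) l≡k l∈J)

  act-supported : ∀ y → All (_∈ J) y → ∀ {β} → SupportedOnJ β → SupportedOnJ (act A y β)
  act-supported []      _             β-supp = β-supp
  act-supported (l ∷ y) (l∈J ∷ y∈J*) {β} β-supp k k∉J =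
    trans (cong₂ (λ x z → x - coroot-pairing l (act A y β) * z) (act-supported y y∈J* β-supp k k∉J) (e-supported l∈J k k∉J))
      (vanish (coroot-pairing l (act A y β)))
    where
    vanish : ∀ c → 0ℤ - c * 0ℤ ≡ 0ℤ
    vanish = solve-∀

  descent-minimal : ∀ v i → InWJ A ℓ J v → ℓ v ≡ suc (ℓ (i ∷ v)) → InWJ A ℓ J (i ∷ v)
  descent-minimal v i v-minimal descent y y∈J* = ℕP.≤-pred (begin
    suc (ℓ (i ∷ v))         ≡⟨ descent ⟨
    ℓ v                     ≤⟨ v-minimal y y∈J* ⟩
    ℓ (v ++ y)              ≤⟨ ℓ-∷-≥ i (v ++ y) ⟩
    suc (ℓ (i ∷ v ++ y))    ∎)
    where open ℕP.≤-Reasoning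

  module _ {w : Word n} (ascents : ∀ j → j ∈ J → ℓ w ℕ.≤ ℓ (w ++ j ∷ [])) where

    act-nonneg : ∀ {β} → SupportedOnJ β → Positive A β → Positive A (act A w β)
    act-nonneg {β} β-supp β≥0 k = subst (0ℤ ℤ.≤_) (sym (act-linear w β k)) (ΣI-nonneg (λ m → β m * act A w (e m) k) term≥0)
      where
      term≥0 : ∀ m → 0ℤ ℤ.≤ β m * act A w (e m) k
      term≥0 m with m ∈? J
      ... | yes m∈J = *-nonneg (β≥0 m) (positivity w m (ascents m m∈J) k)
      ... | no  m∉J = subst (0ℤ ℤ.≤_) (sym (trans (cong (_* act A w (e m) k) (β-supp m m∉J)) (ℤP.*-zeroˡ (act A w (e m) k))))
                        ℤP.≤-refl

    act-nonpos : ∀ {β} → SupportedOnJ β → Negative β → Negative (act A w β)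
    act-nonpos {β} β-supp β≤0 = negate-positive λ k →
      subst (0ℤ ℤ.≤_) (linear-neg (act-linear w) β k)
        (act-nonneg (λ k k∉J → cong -_ (β-supp k k∉J)) (negate-negative β≤0) k)

    -- w sends positive (negative) roots of W_J to positive (negative) roots, so each letter of y
    -- changes the length of w y in the same direction as that of y.
    ℓ-++-parabolic : ∀ y → All (_∈ J) y → ℓ (w ++ y) ≡ ℓ w ℕ.+ ℓ y
    ℓ-++-parabolic y = go y (reverseView y)
      where
      go : ∀ y → Reverse y → All (_∈ J) y → ℓ (w ++ y) ≡ ℓ w ℕ.+ ℓ y
      go .[] [] _ = trans (cong ℓ (LP.++-identityʳ w)) (sym (trans (cong (ℓ w ℕ.+_) ℓ-[]) (ℕP.+-identityʳ (ℓ w))))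
      go .(y ++ l ∷ []) (y ∶ y-view ∶ʳ l) yl∈J* with AllP.∷ʳ⁻ yl∈J*
      ... | y∈J* , l∈J with go y y-view y∈J* | root-sign y l
      ...   | IH | inj₁ yαl≥0 = begin
        ℓ (w ++ y ++ l ∷ [])      ≡⟨ cong ℓ (LP.++-assoc w y (l ∷ [])) ⟨
        ℓ ((w ++ y) ++ l ∷ [])    ≡⟨ positive⇒ascent (w ++ y) l wyαl≥0 ⟩
        suc (ℓ (w ++ y))          ≡⟨ cong suc IH ⟩
        suc (ℓ w ℕ.+ ℓ y)         ≡⟨ ℕP.+-suc (ℓ w) (ℓ y) ⟨
        ℓ w ℕ.+ suc (ℓ y)         ≡⟨ cong (ℓ w ℕ.+_) (positive⇒ascent y l yαl≥0) ⟨
        ℓ w ℕ.+ ℓ (y ++ l ∷ [])   ∎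
        where
        open ≡-Reasoning
        wyαl≥0 : Positive A (act A (w ++ y) (e l))
        wyαl≥0 k = subst (0ℤ ℤ.≤_) (cong (λ γ → γ k) (sym (act-++ w y (e l))))
          (act-nonneg (act-supported y y∈J* (e-supported l∈J)) yαl≥0 k)
      ...   | IH | inj₂ yαl≤0 = ℕP.suc-injective (begin
        suc (ℓ (w ++ y ++ l ∷ []))     ≡⟨ cong (suc ∘ ℓ) (LP.++-assoc w y (l ∷ [])) ⟨
        suc (ℓ ((w ++ y) ++ l ∷ []))   ≡⟨ negative⇒descent (w ++ y) l wyαl≤0 ⟨
        ℓ (w ++ y)                     ≡⟨ IH ⟩
        ℓ w ℕ.+ ℓ y                    ≡⟨ cong (ℓ w ℕ.+_) (negative⇒descent y l yαl≤0) ⟩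
        ℓ w ℕ.+ suc (ℓ (y ++ l ∷ []))  ≡⟨ ℕP.+-suc (ℓ w) _ ⟩
        suc (ℓ w ℕ.+ ℓ (y ++ l ∷ []))  ∎)
        where
        open ≡-Reasoning
        wyαl≤0 : Negative (act A (w ++ y) (e l))
        wyαl≤0 k = subst (ℤ._≤ 0ℤ) (cong (λ γ → γ k) (sym (act-++ w y (e l))))
          (act-nonpos (act-supported y y∈J* (e-supported l∈J)) yαl≤0 k)

    ascents⇒minimal : InWJ A ℓ J w
    ascents⇒minimal y y∈J* = subst (ℓ w ℕ.≤_) (sym (ℓ-++-parabolic y y∈J*)) (ℕP.m≤m+n (ℓ w) (ℓ y))

  deodhar : ∀ x i → InWJ A ℓ J x → ℓ (i ∷ x) ≡ suc (ℓ x) → ¬ InWJ A ℓ J (i ∷ x) →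
    Σ (Fin n) λ j → j ∈ J × i ∷ x ≈ x ++ j ∷ []
  deodhar x i x-minimal ascent not-minimal
    with FinP.any? (λ j → (j ∈? J) ×-dec (ℓ ((i ∷ x) ++ j ∷ []) ℕ.<? ℓ (i ∷ x)))
  ... | no  none = ⊥-elim (not-minimal (ascents⇒minimal (λ j j∈J → ℕP.≮⇒≥ (λ lt → none (j , j∈J , lt)))))
  ... | yes (j , j∈J , descent) = j , j∈J , ≈-sym xj≈ix
    where
    xj-ascent : ℓ (x ++ j ∷ []) ≡ suc (ℓ x)
    xj-ascent with ℓ-∷ʳ x j
    ... | inj₁ up   = up
    ... | inj₂ down = ⊥-elim (ℕP.<⇒≱ (subst (ℓ (x ++ j ∷ []) ℕ.<_) (sym down) (ℕP.n<1+n _))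
                        (x-minimal (j ∷ []) (j∈J ∷ [])))
    ixj-descent : ℓ (i ∷ x) ≡ suc (ℓ (i ∷ x ++ j ∷ []))
    ixj-descent with ℓ-∷ʳ (i ∷ x) j
    ... | inj₁ up   = ⊥-elim (ℕP.<⇒≱ descent (subst (ℓ (i ∷ x) ℕ.≤_) (sym up) (ℕP.n≤1+n _)))
    ... | inj₂ down = down
    x⁻¹αi≗αj : act A (reverse x) (e i) ≗ e j
    x⁻¹αi≗αj = simple-root (reverse x) i j (left-ascent⇒positive i x ascent) λ k →
      subst (ℤ._≤ 0ℤ) (cong (λ z → act A z (e i) k) (LP.reverse-++ x (j ∷ [])))
        (left-descent⇒negative i (x ++ j ∷ []) (trans xj-ascent (trans (sym ascent) ixj-descent)) k)
    xj≈ix : x ++ j ∷ [] ≈ i ∷ x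
    xj≈ix = ≈-trans (++-congˡ x (≈-sym (reflectionWord-simple (reverse x) i j x⁻¹αi≗αj)))
      (++-reflectionWord-reverse x i)

-- The commutation relation

module Duality {n : ℕ} (A : Matrix n) (gcm : IsGCM A) (a k : Fin n → ℕ) (central : IsCentral A k)
               (J : Subset n) (a-J : ∀ j → j ∈ J → a j ≡ 0)
               (ℓ : Word n → ℕ) (isLength : IsLength A ℓ) (decWJ : ∀ w → Dec (InWJ A ℓ J w))
               (sm : Word n → Word n → ℤ) (isStrongMult : IsStrongMult A ℓ a sm) where
  open WeylGroup A (proj₁ gcm)
  open Length A (proj₁ gcm) ℓ isLength
  open Roots A gcm ℓ isLength
  open Parabolic A gcm ℓ isLength J

  K : Vecℤ n
  K i = + k i

  coact-K : ∀ w → coact A w K ≗ K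
  coact-K []      l = refl
  coact-K (i ∷ w) l = begin
    coact A w K l - root-pairing i (coact A w K) * e i l  ≡⟨ cong₂ (λ x y → x - y * e i l) (coact-K w l) pairing ⟩
    K l - 0ℤ * e i l                                      ≡⟨ minus-zero (K l) (e i l) ⟩
    K l                                                   ∎
    where
    open ≡-Reasoning
    pairing : root-pairing i (coact A w K) ≡ 0ℤ
    pairing = trans (ΣI-cong n (λ j → cong (_* A j i) (coact-K w j))) (central i)
    minus-zero : ∀ x y → x - 0ℤ * y ≡ x
    minus-zero = solve-∀

  ⟨_,Λ⟩ : Vecℤ n → ℤ
  ⟨ γ ,Λ⟩ = pairΛ A a γ

  coroot-value : Word n → Fin n → ℤ
  coroot-value u j = ⟨ coact A u (e j) ,Λ⟩

  ⟨,Λ⟩-cong : ∀ {γ δ} → γ ≗ δ → ⟨ γ ,Λ⟩ ≡ ⟨ δ ,Λ⟩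
  ⟨,Λ⟩-cong γ≗δ = ΣI-cong n (λ i → cong (_* + a i) (γ≗δ i))

  ⟨,Λ⟩-neg : ∀ γ → ⟨ (λ l → - γ l) ,Λ⟩ ≡ - ⟨ γ ,Λ⟩
  ⟨,Λ⟩-neg γ = trans (ΣI-cong n (λ i → sym (ℤP.neg-distribˡ-* (γ i) (+ a i)))) (ΣI-distrib-neg (λ i → γ i * + a i))

  coroot-value-J : ∀ {j} → j ∈ J → coroot-value [] j ≡ 0ℤ
  coroot-value-J {j} j∈J = trans (ΣI-selectˡ n j (λ i → + a i)) (cong +_ (a-J j j∈J))

  -- Σ k_i ⟨w α_i^∨, Λ⟩ = ⟨w K, Λ⟩ = ⟨K, Λ⟩ since the central element K is W-invariant.
  coroot-values-sum : ∀ w → ΣI n (λ i → K i * coroot-value w i) ≡ pairKΛ k a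
  coroot-values-sum w = begin
    ΣI n (λ i → K i * ΣI n (λ l → coact A w (e i) l * + a l))
      ≡⟨ ΣI-cong n (λ i → *-distribˡ-ΣI (K i) (λ l → coact A w (e i) l * + a l)) ⟩
    ΣI n (λ i → ΣI n (λ l → K i * (coact A w (e i) l * + a l)))
      ≡⟨ ΣI-comm (λ i l → K i * (coact A w (e i) l * + a l)) ⟩
    ΣI n (λ l → ΣI n (λ i → K i * (coact A w (e i) l * + a l)))
      ≡⟨ ΣI-cong n (λ l → trans (ΣI-cong n (λ i → sym (ℤP.*-assoc (K i) _ (+ a l))))
                                (sym (*-distribʳ-ΣI (+ a l) (λ i → K i * coact A w (e i) l)))) ⟩
    ΣI n (λ l → ΣI n (λ i → K i * coact A w (e i) l) * + a l)
      ≡⟨ ΣI-cong n (λ l → cong (_* + a l) (trans (sym (coact-linear w K l)) (coact-K w l))) ⟩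
    ΣI n (λ l → K l * + a l)
      ≡⟨ ΣI-cong n (λ l → sym (ℤP.pos-* (k l) (a l))) ⟩
    pairKΛ k a
      ∎
    where open ≡-Reasoning

  sm-cover : ∀ {v w} u j → Cover v w u j → sm v w ≡ coroot-value u j
  sm-cover {v} {w} u j (w≈vt , β≥0 , ℓw≡) = proj₁ (isStrongMult v w) u j (≈⇒≈W w≈vt , β≥0 , ℓw≡)

  sm-no-cover : ∀ {v w} → (∀ u j → ¬ Cover v w u j) → sm v w ≡ 0ℤ
  sm-no-cover {v} {w} no-cover = proj₂ (isStrongMult v w)
    λ (u , j , w≈vt , β≥0 , ℓw≡) → no-cover u j (≈W⇒≈ w≈vt , β≥0 , ℓw≡)

  -- Equality of integers is stable, so we may argue by cases on the (undecidable) existence of a cover.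
  sm-cong : ∀ {v w v′ w′} → (∀ {u j} → Cover v w u j → Cover v′ w′ u j) → (∀ {u j} → Cover v′ w′ u j → Cover v w u j) →
    sm v w ≡ sm v′ w′
  sm-cong {v} {w} {v′} {w′} to from = decidable-stable (sm v w ℤ.≟ sm v′ w′) λ sm≢sm′ →
    sm≢sm′ (trans (sm-no-cover λ u j cover → sm≢sm′ (trans (sm-cover u j cover) (sym (sm-cover u j (to cover)))))
                  (sym (sm-no-cover λ u j cover → sm≢sm′ (trans (sm-cover u j (from cover)) (sym (sm-cover u j cover))))))

  ascent-cover : ∀ {v x} i → v ≈ x → ℓ (i ∷ x) ≡ suc (ℓ x) → Cover v (i ∷ x) (reverse v) i
  ascent-cover {v} {x} i v≈x ascent =
    ≈-sym (≈-trans (++-reflectionWord-reverse v i) (∷-cong i v≈x)) ,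
    left-ascent⇒positive i v (trans (ℓ-cong (∷-cong i v≈x)) ℓix≡) ,
    ℓix≡
    where
    ℓix≡ : ℓ (i ∷ x) ≡ suc (ℓ v)
    ℓix≡ = trans ascent (cong suc (ℓ-cong (≈-sym v≈x)))

  descent-cover : ∀ {v x} i → v ≈ x → ℓ v ≡ suc (ℓ (i ∷ v)) → Cover (i ∷ v) x (reverse (i ∷ v)) i
  descent-cover {v} {x} i v≈x descent =
    ≈-sym (≈-trans (++-reflectionWord-reverse (i ∷ v) i) (≈-trans (∷-involutive i v) v≈x)) ,
    (λ l → subst (0ℤ ℤ.≤_) (sym (flipped l)) (negate-negative (left-descent⇒negative i v descent) l)) ,
    trans (ℓ-cong (≈-sym v≈x)) descent
    where
    flipped : act A (reverse (i ∷ v)) (e i) ≗ (λ l → - act A (reverse v) (e i) l)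
    flipped l = trans (cong (λ u → act A u (e i) l) (LP.unfold-reverse i v)) (act-∷ʳ-root (reverse v) i l)

  coroot-value-descent : ∀ v i → coroot-value (reverse (i ∷ v)) i ≡ - coroot-value (reverse v) i
  coroot-value-descent v i = trans (⟨,Λ⟩-cong flipped) (⟨,Λ⟩-neg (coact A (reverse v) (e i)))
    where
    flipped : coact A (reverse (i ∷ v)) (e i) ≗ (λ l → - coact A (reverse v) (e i) l)
    flipped l = begin
      coact A (reverse (i ∷ v)) (e i) l              ≡⟨ cong (λ u → coact A u (e i) l) (LP.unfold-reverse i v) ⟩
      coact A (reverse v ++ i ∷ []) (e i) l          ≡⟨ cong (λ γ → γ l) (coact-++ (reverse v) (i ∷ []) (e i)) ⟩
      coact A (reverse v) (sCoroot A i (e i)) l      ≡⟨ linear-cong (coact-linear (reverse v)) (sCoroot-root i) l ⟩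
      coact A (reverse v) (λ l → - e i l) l          ≡⟨ linear-neg (coact-linear (reverse v)) (e i) l ⟩
      - coact A (reverse v) (e i) l                  ∎
      where open ≡-Reasoning

  module _ {v x : Word n} {i : Fin n} (ascent-x : ℓ (i ∷ x) ≡ suc (ℓ x)) (descent-v : ℓ v ≡ suc (ℓ (i ∷ v))) where

    cover-transfer : ∀ {u j} → Cover v (i ∷ x) u j → Cover (i ∷ v) x u j
    cover-transfer (ix≈vt , β≥0 , ℓix≡) =
      ≈-trans (≈-sym (∷-involutive i x)) (∷-cong i ix≈vt) , β≥0 ,
      ℕP.suc-injective (trans (sym ascent-x) (trans ℓix≡ (cong suc descent-v)))

    cover-transfer⁻¹ : ∀ {u j} → Cover (i ∷ v) x u j → Cover v (i ∷ x) u j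
    cover-transfer⁻¹ {u} {j} (x≈ivt , β≥0 , ℓx≡) =
      ≈-trans (∷-cong i x≈ivt) (∷-involutive i (v ++ reflectionWord u j)) , β≥0 ,
      trans ascent-x (cong suc (trans ℓx≡ (sym descent-v)))

  not-ascent : ∀ i w → ¬ ℓ (i ∷ w) ≡ suc (ℓ w) → ℓ w ≡ suc (ℓ (i ∷ w))
  not-ascent i w ¬ascent with ℓ-∷ i w
  ... | inj₁ ascent  = ⊥-elim (¬ascent ascent)
  ... | inj₂ descent = descent

  not-descent : ∀ i w → ¬ ℓ w ≡ suc (ℓ (i ∷ w)) → ℓ (i ∷ w) ≡ suc (ℓ w)
  not-descent i w ¬descent with ℓ-∷ i w
  ... | inj₁ ascent  = ascent
  ... | inj₂ descent = ⊥-elim (¬descent descent)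

  module Terms (v x : Word n) (v-minimal : InWJ A ℓ J v) (x-minimal : InWJ A ℓ J x) where

    -- The summands of DUcoef and UDcoef with the decisions abstracted, so that they can be split by cases.
    up-term : ∀ i → Dec (ℓ (i ∷ x) ≡ suc (ℓ x)) → Dec (InWJ A ℓ J (i ∷ x)) → ℤ
    up-term i d₁ d₃ = if does d₁ ∧ does d₃ then sm v (i ∷ x) * K i else 0ℤ

    down-term : ∀ i → Dec (ℓ v ≡ suc (ℓ (i ∷ v))) → Dec (InWJ A ℓ J (i ∷ v)) → ℤ
    down-term i d₂ d₄ = if does d₂ ∧ does d₄ then K i * sm (i ∷ v) x else 0ℤ

    module Equal (v≈x : v ≈ x) (i : Fin n) where

      c : ℤ
      c = coroot-value (reverse v) i

      ℓv≡ℓx : ℓ v ≡ ℓ x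
      ℓv≡ℓx = ℓ-cong v≈x

      ascent-transfer : ℓ (i ∷ x) ≡ suc (ℓ x) → ℓ (i ∷ v) ≡ suc (ℓ v)
      ascent-transfer ascent = trans (ℓ-cong (∷-cong i v≈x)) (trans ascent (cong suc (sym ℓv≡ℓx)))

      value-outside-J : ℓ (i ∷ x) ≡ suc (ℓ x) → ¬ InWJ A ℓ J (i ∷ x) → c ≡ 0ℤ
      value-outside-J ascent ix∉WJ with deodhar x i x-minimal ascent ix∉WJ
      ... | j , j∈J , ix≈xj = begin
        c                      ≡⟨ sm-cover (reverse v) i (ascent-cover i v≈x ascent) ⟨
        sm v (i ∷ x)           ≡⟨ sm-cover [] j J-cover ⟩
        coroot-value [] j      ≡⟨ coroot-value-J j∈J ⟩
        0ℤ                     ∎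
        where
        open ≡-Reasoning
        J-cover : Cover v (i ∷ x) [] j
        J-cover = ≈-trans ix≈xj (++-congʳ (j ∷ []) (≈-sym v≈x)) , e-nonneg j ,
          trans ascent (cong suc (sym ℓv≡ℓx))

      term : ∀ d₁ d₂ d₃ d₄ → up-term i d₁ d₃ - down-term i d₂ d₄ ≡ K i * c
      term (yes ascent) (yes descent) _ _ =
        ⊥-elim (ℕP.<⇒≢ (ℕP.m<n⇒m<1+n (ℕP.n<1+n _)) (trans descent (cong suc (ascent-transfer ascent))))
      term (no ¬ascent) (no ¬descent) _ _ =
        ⊥-elim (¬ascent (trans (ℓ-cong (∷-cong i (≈-sym v≈x))) (trans (not-descent i v ¬descent) (cong suc ℓv≡ℓx))))
      term (yes ascent) (no _) (yes _) _ =
        trans (cong (λ s → s * K i - 0ℤ) (sm-cover (reverse v) i (ascent-cover i v≈x ascent))) (swap c (K i))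
        where
        swap : ∀ c k → c * k - 0ℤ ≡ k * c
        swap = solve-∀
      term (yes ascent) (no _) (no ix∉WJ) _ =
        sym (trans (cong (K i *_) (value-outside-J ascent ix∉WJ)) (ℤP.*-zeroʳ (K i)))
      term (no _) (yes descent) _ (no iv∉WJ) = ⊥-elim (iv∉WJ (descent-minimal v i v-minimal descent))
      term (no _) (yes descent) _ (yes _) =
        trans (cong (λ s → 0ℤ - K i * s) (trans (sm-cover (reverse (i ∷ v)) i (descent-cover i v≈x descent)) (coroot-value-descent v i)))
          (double-negation (K i) c)
        where
        double-negation : ∀ k c → 0ℤ - k * (- c) ≡ k * c
        double-negation = solve-∀

    module Distinct (v≉x : ¬ v ≈ x) (i : Fin n) where

      cancel-∷ : i ∷ v ≈ i ∷ x → v ≈ x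
      cancel-∷ iv≈ix = ≈-trans (≈-sym (∷-involutive i v)) (≈-trans (∷-cong i iv≈ix) (∷-involutive i x))

      no-cover-ascents : ℓ (i ∷ x) ≡ suc (ℓ x) → ℓ (i ∷ v) ≡ suc (ℓ v) → sm v (i ∷ x) ≡ 0ℤ
      no-cover-ascents ascent-x ascent-v = sm-no-cover λ u j cover → v≉x (lifting i u j cover ascent-x ascent-v)

      no-cover-descents : ℓ x ≡ suc (ℓ (i ∷ x)) → ℓ v ≡ suc (ℓ (i ∷ v)) → sm (i ∷ v) x ≡ 0ℤ
      no-cover-descents descent-x descent-v = sm-no-cover λ u j (x≈ivt , β≥0 , ℓx≡) →
        v≉x (cancel-∷ (lifting i u j
          (≈-trans (∷-involutive i x) x≈ivt , β≥0 , trans (ℓ-cong (∷-involutive i x)) ℓx≡)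
          (trans (ℓ-cong (∷-involutive i x)) descent-x)
          (trans (ℓ-cong (∷-involutive i v)) descent-v)))

      no-cover-outside-J : ℓ (i ∷ x) ≡ suc (ℓ x) → ℓ v ≡ suc (ℓ (i ∷ v)) → ¬ InWJ A ℓ J (i ∷ x) →
        sm (i ∷ v) x ≡ 0ℤ
      no-cover-outside-J ascent-x descent-v ix∉WJ with deodhar x i x-minimal ascent-x ix∉WJ
      ... | j , j∈J , ix≈xj = sm-no-cover λ u j′ cover →
        v≉x (lifting-parabolic J i j u j′ v-minimal j∈J ix≈xj (cover-transfer⁻¹ ascent-x descent-v cover) ascent-x)

      vanish : ∀ k → 0ℤ - k * 0ℤ ≡ 0ℤ
      vanish = solve-∀

      term : ∀ d₁ d₂ d₃ d₄ → up-term i d₁ d₃ - down-term i d₂ d₄ ≡ 0ℤ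
      term (yes ascent) (yes descent) (yes _) (yes _) =
        trans (cong (λ s → s * K i - K i * sm (i ∷ v) x)
                    (sm-cong (cover-transfer ascent descent) (cover-transfer⁻¹ ascent descent)))
          (commute (sm (i ∷ v) x) (K i))
        where
        commute : ∀ s k → s * k - k * s ≡ 0ℤ
        commute = solve-∀
      term (yes _) (yes descent) _ (no iv∉WJ) = ⊥-elim (iv∉WJ (descent-minimal v i v-minimal descent))
      term (yes ascent) (yes descent) (no ix∉WJ) (yes _) =
        trans (cong (λ s → 0ℤ - K i * s) (no-cover-outside-J ascent descent ix∉WJ)) (vanish (K i))
      term (yes ascent) (no ¬descent) (yes _) _ =
        cong (λ s → s * K i - 0ℤ) (no-cover-ascents ascent (not-descent i v ¬descent))
      term (yes _) (no _) (no _) _ = refl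
      term (no ¬ascent) (yes descent) _ (yes _) =
        trans (cong (λ s → 0ℤ - K i * s) (no-cover-descents (not-ascent i x ¬ascent) descent)) (vanish (K i))
      term (no _) (yes _) _ (no _) = refl
      term (no _) (no _) _ _ = refl

    up-terms down-terms : Fin n → ℤ
    up-terms   i = up-term i (ℓ (i ∷ x) ℕ.≟ suc (ℓ x)) (decWJ (i ∷ x))
    down-terms i = down-term i (ℓ v ℕ.≟ suc (ℓ (i ∷ v))) (decWJ (i ∷ v))

    sum-of-terms : (v≈?x : Dec (_≈W_ A v x)) →
      ΣI n (λ i → up-terms i - down-terms i) ≡ (if does v≈?x then pairKΛ k a else 0ℤ)
    sum-of-terms (yes v≈x) = trans
      (ΣI-cong n λ i → Equal.term (≈W⇒≈ v≈x) i
        (ℓ (i ∷ x) ℕ.≟ suc (ℓ x)) (ℓ v ℕ.≟ suc (ℓ (i ∷ v))) (decWJ (i ∷ x)) (decWJ (i ∷ v)))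
      (coroot-values-sum (reverse v))
    sum-of-terms (no v≉x) = trans
      (ΣI-cong n λ i → Distinct.term (v≉x ∘ ≈⇒≈W) i
        (ℓ (i ∷ x) ℕ.≟ suc (ℓ x)) (ℓ v ℕ.≟ suc (ℓ (i ∷ v))) (decWJ (i ∷ x)) (decWJ (i ∷ v)))
      (ΣI-zero n)

proposition2p16 :
  ∀ {n : ℕ} (A : Matrix n) → IsGCM A →
  (a : Fin n → ℕ) →
  (k : Fin n → ℕ) → IsCentral A k →
  (J : Subset n) → (∀ j → j ∈ J → a j ≡ 0) →
  (ℓ : Word n → ℕ) → IsLength A ℓ →
  (decWJ : ∀ w → Dec (InWJ A ℓ J w)) →
  (sm : Word n → Word n → ℤ) → IsStrongMult A ℓ a sm →
  ∀ v x → InWJ A ℓ J v → InWJ A ℓ J x →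
  DUcoef A ℓ J decWJ k sm v x - UDcoef A ℓ J decWJ k sm v x
    ≡ IdCoef A (pairKΛ k a) v x
proposition2p16 A gcm a k central J a-J ℓ isLength decWJ sm isStrongMult v x v-minimal x-minimal =
  trans (sym (ΣI-distrib-- up-terms down-terms)) (sum-of-terms (_≈W?_ A v x))
  where open Duality A gcm a k central J a-J ℓ isLength decWJ sm isStrongMult
        open Terms v x v-minimal x-minimal
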